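{- Let $S$ be a Sidon set in $\mathbb{F}_2^n$. (i) If $(n,|S|)\in\{(6,9),(7,12)\}$, then $S$ contains a gerbera configuration of size $3$, and $S$ contains no gerbera configuration of size $4$. (ii) If $(n,|S|)\in\{(8,17),(8,18),(9,22),(9,23),(9,24)\}$, then $S$ contains a gerbera configuration of size $4$.
   Context: A subset $S$ of an abelian group is a Sidon set if for any $x,y,z,w\in S$ of which at least three are distinct, $x+y\neq z+w$. For $w\in\mathbb{F}_2^n$, a $w$-centered gerbera configuration of size $t$ is a collection $\mathcal{T}$ of $t$ distinct subsets $T_i=\{x_i,y_i,z_i\}\subseteq\mathbb{F}_2^n$ ($i=1,\dots,t$) with $|T_i|=3$ and $x_i+y_i+z_i=w$ for all $i$; a gerbera configuration is one that is $w$-centered for some $w$. It is contained in $S$ if $T_i\subseteq S$ for all $i$. -}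

module Defs where

open import Data.Bool using (Bool; _xor_)
open import Data.Nat using (ℕ)
open import Data.Fin using (Fin)
open import Data.Vec using (Vec; zipWith)
open import Data.List using (List; length)
open import Data.List.Membership.Propositional using (_∈_)
open import Data.List.Relation.Unary.Unique.Propositional using (Unique)
open import Data.Product using (Σ; _×_; _,_)
open import Data.Sum using (_⊎_)
open import Relation.Binary.PropositionalEquality using (_≡_; _≢_)
open import Function.Bundles using (_⇔_)

F₂^ : ℕ → Set
F₂^ n = Vec Bool n

infixl 6 _⊕_
_⊕_ : ∀ {n} → F₂^ n → F₂^ n → F₂^ n
_⊕_ = zipWith _xor_

record FinSubset (n : ℕ) : Set where
  constructor mkFinSubset
  field
    elems  : List (F₂^ n)
    unique : Unique elems

open FinSubset public

_∈S_ : ∀ {n} → F₂^ n → FinSubset n → Set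
x ∈S S = x ∈ elems S

∣_∣ : ∀ {n} → FinSubset n → ℕ
∣ S ∣ = length (elems S)

AtLeastThreeDistinct : ∀ {A : Set} → A → A → A → A → Set
AtLeastThreeDistinct x y z w =
    (x ≢ y × x ≢ z × y ≢ z)
  ⊎ (x ≢ y × x ≢ w × y ≢ w)
  ⊎ (x ≢ z × x ≢ w × z ≢ w)
  ⊎ (y ≢ z × y ≢ w × z ≢ w)

Sidon : ∀ {n} → FinSubset n → Set
Sidon S = ∀ x y z w → x ∈S S → y ∈S S → z ∈S S → w ∈S S →
          AtLeastThreeDistinct x y z w → x ⊕ y ≢ z ⊕ w

-- A 3-subset {x,y,z} given by an (ordered) triple of its elements.
Triple : ℕ → Set
Triple n = F₂^ n × F₂^ n × F₂^ n

_∈T_ : ∀ {n} → F₂^ n → Triple n → Set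
v ∈T (x , y , z) = v ≡ x ⊎ v ≡ y ⊎ v ≡ z

SameSet : ∀ {n} → Triple n → Triple n → Set
SameSet {n} T T′ = ∀ (v : F₂^ n) → (v ∈T T) ⇔ (v ∈T T′)

IsCenteredGerbera : ∀ {n} (t : ℕ) → F₂^ n → (Fin t → Triple n) → Set
IsCenteredGerbera t w T =
    (∀ i → let (x , y , z) = T i in
             x ≢ y × x ≢ z × y ≢ z × x ⊕ y ⊕ z ≡ w)
  × (∀ i j → SameSet (T i) (T j) → i ≡ j)

ContainsGerbera : ∀ {n} → ℕ → FinSubset n → Set
ContainsGerbera {n} t S =
  Σ (F₂^ n) λ w → Σ (Fin t → Triple n) λ T →
    IsCenteredGerbera t w T
    × (∀ i → let (x , y , z) = T i in x ∈S S × y ∈S S × z ∈S S)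

{-# OPTIONS --safe #-}
-- Identify a subset of S with its indicator vector p ∈ F₂^∣S∣ and send it to
-- key p = Σ_{x ∈ p} (1, x) ∈ F₂ⁿ⁺¹.  The kernel of this linear map is a binary code whose nonzero
-- words have even weight and sum to 0, hence (S being Sidon) weight at least 6.  A w-centred 3-subset
-- ("triangle") has key (1, w), so two distinct triangles with a common centre differ by a codeword of
-- weight at most 6 and are disjoint: a gerbera of size k is just k distinct triangles with a common centre.
-- Pigeonhole on key gives many codewords.  For ∣S∣ = 9 three words of one fibre are pairwise at distance
-- exactly 6 by the Plotkin bound, and such codewords c₁, c₂, c₁ ⊕ c₂ split into three triangles; for ∣S∣ = 12
-- the same configuration comes from R(3,5) ≤ 15 and the Plotkin bound; for ∣S∣ = 17 two disjoint weight-6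
-- codewords c, c′ and a third codeword inside c ∪ c′ split into four triangles; in the remaining cases
-- (∣S∣ choose 3) > 3 · 2ⁿ, so four triangles share a centre.  Conversely four disjoint triangles need 12
-- points, and when n = 7 their union carries 16 codewords whereas the weight constraints allow only 8.
module Submission where

open import Defs
open import Algebra.Bundles using (AbelianGroup; CommutativeMonoid)
import Algebra.Lattice.Properties.BooleanAlgebra as BooleanAlgebraProperties
import Algebra.Properties.AbelianGroup as AbelianGroupProperties
import Algebra.Properties.CommutativeSemigroup as CommutativeSemigroupProperties
open import Data.Bool using (Bool; true; false; not; _xor_; if_then_else_)
open import Data.Bool.Properties using (xor-is-ok; ¬-not) renaming (_≟_ to _≟ᵇ_)
open import Data.Empty using (⊥)
open import Data.Fin using (Fin; zero; suc)
open import Data.Fin.Subset using (Subset; _∩_; _∪_; ∁; ⊤) renaming (⊥ to ∅; ∣_∣ to weight)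
open import Data.Fin.Subset.Properties
  using (∪-∩-booleanAlgebra; ∩-commutativeMonoid; ∩-comm; ∩-assoc; ∩-idem; ∩-zeroʳ; ∩-identityʳ; ∩-inverseʳ;
         ∣⊥∣≡0; ∣p∣≤n; ∣⊤∣≡n; ∣∁p∣≡n∸∣p∣)
open import Data.List using (List; []; _∷_; length; map; filter; _++_; foldr; lookup; tabulate)
open import Data.List.Properties using (map-∘; length-map; length-++; length-tabulate)
open import Data.List.Membership.Propositional using (_∈_; _∉_; find)
open import Data.List.Membership.Propositional.Properties using (∈-map⁻; ∈-lookup; ∈-filter⁺; ∈-filter⁻)
open import Data.List.Membership.Propositional.Properties.WithK using (unique∧set⇒bag)
import Data.List.Membership.DecPropositional as DecMembership
open import Data.List.Relation.Binary.BagAndSetEquality using (∼bag⇒↭)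
open import Data.List.Relation.Binary.Permutation.Propositional as Perm using (_↭_)
open import Data.List.Relation.Binary.Permutation.Propositional.Properties using (↭-length)
open import Data.List.Relation.Binary.Sublist.Propositional using (_⊆_; []; _∷_; _∷ʳ_; ⊆-refl; ⊆-trans; minimum)
open import Data.List.Relation.Binary.Sublist.Propositional.Properties using (All-resp-⊆; Any-resp-⊆; filter-⊆)
open import Data.List.Relation.Unary.All as All using (All; []; _∷_)
open import Data.List.Relation.Unary.All.Properties using (all-filter)
  renaming (map⁺ to All-map⁺; ++⁺ to All-++⁺; tabulate⁺ to All-tabulate⁺)
open import Data.List.Relation.Unary.All.Properties.Core using (¬All⇒Any¬)
open import Data.List.Relation.Unary.AllPairs as AllPairs using (AllPairs; []; _∷_)
open import Data.List.Relation.Unary.AllPairs.Properties using () renaming (tabulate⁺ to AllPairs-tabulate⁺)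
open import Data.List.Relation.Unary.Any using (here; there)
open import Data.List.Relation.Unary.Unique.Propositional using (Unique)
import Data.List.Relation.Unary.Unique.Propositional.Properties as Unique
open import Data.Nat using (ℕ; zero; suc; _+_; _*_; _∸_; _^_; _≤_; _<_; z≤n; s≤s) renaming (_≟_ to _≟ⁿ_)
open import Data.Nat.Combinatorics using (_C_; nCk+nC[k+1]≡[n+1]C[k+1])
open import Data.Nat.DivMod using (_/_; m*n/n≡m; /-monoˡ-≤)
open import Data.Nat.ListAction using (sum)
open import Data.Nat.Properties
  using (+-suc; +-identityʳ; +-comm; +-assoc; +-cancelʳ-≡; +-cancelʳ-≤; +-cancelˡ-≡; +-cancelˡ-≤; +-cancelˡ-<;
         *-cancelˡ-≤; *-cancelˡ-≡; *-comm; *-suc; *-identityʳ; ≤-antisym; ≤-refl; ≤-reflexive; ≤-trans; ≤-total; ≤-pred;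
         +-mono-≤; +-monoˡ-≤; +-monoʳ-≤; m≤m+n; m≤n⇒∃[o]m+o≡n; n≤1+n; ≮⇒≥; ≰⇒>; <⇒≱; <-≤-trans; _<?_; _≤?_;
         +-commutativeSemigroup; module ≤-Reasoning)
open import Data.Nat.Tactic.RingSolver using (solve-∀)
open import Data.Product using (_×_; _,_; ∃-syntax; proj₁; proj₂)
open import Data.Sum as Sum using (_⊎_; inj₁; inj₂; [_,_]′)
open import Data.Vec using (Vec; []; _∷_; head; tail)
open import Data.Vec.Properties using (∷-injectiveʳ; ≡-dec)
open import Function using (_∘_)
open import Function.Bundles using (mk⇔; Equivalence)
open import Level using (0ℓ)
open import Relation.Binary.Definitions using (DecidableEquality)
open import Relation.Binary.PropositionalEquality
open import Relation.Nullary using (¬_; Dec; yes; no; does; contradiction)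
open import Relation.Nullary.Decidable using (_⊎-dec_; from-yes; from-no)
open import Relation.Unary using (Decidable)
open import Relation.Unary.Properties using (∁?)

-- Subsets as a Boolean ring

⊕-def : ∀ {m} (p q : Subset m) → p ⊕ q ≡ (p ∪ q) ∩ ∁ (p ∩ q)
⊕-def []      []      = refl
⊕-def (a ∷ p) (b ∷ q) = cong₂ _∷_ (xor-is-ok a b) (⊕-def p q)

module _ {m : ℕ} where
  open BooleanAlgebraProperties (∪-∩-booleanAlgebra m) using (module XorRing)
  open XorRing _⊕_ ⊕-def public
    using (⊕-comm; ⊕-assoc; ⊕-identityˡ; ⊕-identityʳ)
    renaming (∧-distribˡ-⊕ to ∩-distribˡ-⊕; ∧-distribʳ-⊕ to ∩-distribʳ-⊕)

  ⊕-abelianGroup : AbelianGroup 0ℓ 0ℓ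
  ⊕-abelianGroup = record { isAbelianGroup = XorRing.⊕-⊥-isAbelianGroup _⊕_ ⊕-def }

  open AbelianGroupProperties ⊕-abelianGroup public
    using () renaming (x∙y⁻¹≈ε⇒x≈y to p⊕q≡∅⇒p≡q; x≈y⇒x∙y⁻¹≈ε to p≡q⇒p⊕q≡∅; xyx⁻¹≈y to p⊕q⊕p≡q; ∙-cancelˡ to ⊕-cancelˡ)
  open CommutativeSemigroupProperties (AbelianGroup.commutativeSemigroup ⊕-abelianGroup) public
    using () renaming (interchange to ⊕-interchange; x∙yz≈y∙xz to ⊕-exchangeˡ)
  open CommutativeSemigroupProperties (CommutativeMonoid.commutativeSemigroup (∩-commutativeMonoid m)) public
    using () renaming (interchange to ∩-interchange)

Disjoint : ∀ {m} → Subset m → Subset m → Set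
Disjoint p q = p ∩ q ≡ ∅

-- The order of the Boolean algebra, stated equationally (the library's _⊆_ is membership-based).
_⊑_ : ∀ {m} → Subset m → Subset m → Set
p ⊑ q = p ∩ q ≡ p

p∩q⊑p : ∀ {m} (p q : Subset m) → (p ∩ q) ⊑ p
p∩q⊑p p q = trans (∩-comm (p ∩ q) p) (trans (sym (∩-assoc p p q)) (cong (_∩ q) (∩-idem p)))

p∩q⊑q : ∀ {m} (p q : Subset m) → (p ∩ q) ⊑ q
p∩q⊑q p q = trans (∩-assoc p q q) (cong (p ∩_) (∩-idem q))

⊑-disjoint : ∀ {m} {p′ q′ p q : Subset m} → p′ ⊑ p → q′ ⊑ q → Disjoint p q → Disjoint p′ q′
⊑-disjoint {p′ = p′} {q′} {p} {q} p′⊑p q′⊑q p∩q≡∅ = begin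
  p′ ∩ q′              ≡⟨ cong₂ _∩_ p′⊑p q′⊑q ⟨
  (p′ ∩ p) ∩ (q′ ∩ q)  ≡⟨ ∩-interchange p′ p q′ q ⟩
  (p′ ∩ q′) ∩ (p ∩ q)  ≡⟨ cong ((p′ ∩ q′) ∩_) p∩q≡∅ ⟩
  (p′ ∩ q′) ∩ ∅        ≡⟨ ∩-zeroʳ (p′ ∩ q′) ⟩
  ∅                    ∎
  where open ≡-Reasoning

all⊑⊤ : ∀ {m} (ps : List (Subset m)) → All (_⊑ ⊤) ps
all⊑⊤ = All.universal ∩-identityʳ

⊑-⊕ : ∀ {m} {p q z : Subset m} → p ⊑ z → q ⊑ z → (p ⊕ q) ⊑ z
⊑-⊕ {p = p} {q} {z} p⊑z q⊑z = trans (∩-distribʳ-⊕ z p q) (cong₂ _⊕_ p⊑z q⊑z)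

disjoint-⊕ˡ : ∀ {m} {p q r : Subset m} → Disjoint p r → Disjoint q r → Disjoint (p ⊕ q) r
disjoint-⊕ˡ {p = p} {q} {r} p∩r≡∅ q∩r≡∅ = trans (∩-distribʳ-⊕ r p q) (trans (cong₂ _⊕_ p∩r≡∅ q∩r≡∅) (⊕-identityʳ ∅))

disjoint-⊕ʳ : ∀ {m} {p q r : Subset m} → Disjoint p q → Disjoint p r → Disjoint p (q ⊕ r)
disjoint-⊕ʳ {p = p} {q} {r} p∩q≡∅ p∩r≡∅ = trans (∩-distribˡ-⊕ p q r) (trans (cong₂ _⊕_ p∩q≡∅ p∩r≡∅) (⊕-identityʳ ∅))

p⊕[q⊕p]≡q : ∀ {m} (p q : Subset m) → p ⊕ (q ⊕ p) ≡ q
p⊕[q⊕p]≡q p q = trans (sym (⊕-assoc p q p)) (p⊕q⊕p≡q p q)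

[p⊕r]⊕[q⊕r]≡p⊕q : ∀ {m} (p q r : Subset m) → (p ⊕ r) ⊕ (q ⊕ r) ≡ p ⊕ q
[p⊕r]⊕[q⊕r]≡p⊕q p q r = begin
  (p ⊕ r) ⊕ (q ⊕ r)  ≡⟨ ⊕-interchange p r q r ⟩
  (p ⊕ q) ⊕ (r ⊕ r)  ≡⟨ cong ((p ⊕ q) ⊕_) (p≡q⇒p⊕q≡∅ {x = r} refl) ⟩
  (p ⊕ q) ⊕ ∅        ≡⟨ ⊕-identityʳ (p ⊕ q) ⟩
  p ⊕ q              ∎
  where open ≡-Reasoning

[r⊕p]⊕[r⊕q]≡p⊕q : ∀ {m} (p q r : Subset m) → (r ⊕ p) ⊕ (r ⊕ q) ≡ p ⊕ q
[r⊕p]⊕[r⊕q]≡p⊕q p q r = trans (cong₂ _⊕_ (⊕-comm r p) (⊕-comm r q)) ([p⊕r]⊕[q⊕r]≡p⊕q p q r)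

≢-by-⊕ : ∀ {m} {p q r : Subset m} → p ⊕ q ≡ r → r ≢ ∅ → p ≢ q
≢-by-⊕ p⊕q≡r r≢∅ p≡q = r≢∅ (trans (sym p⊕q≡r) (p≡q⇒p⊕q≡∅ p≡q))

p≢q⇒p⊕q≢∅ : ∀ {m} {p q : Subset m} → p ≢ q → p ⊕ q ≢ ∅
p≢q⇒p⊕q≢∅ {p = p} {q} p≢q = p≢q ∘ p⊕q≡∅⇒p≡q p q

weight-⊕ : ∀ {m} (p q : Subset m) → weight (p ⊕ q) + 2 * weight (p ∩ q) ≡ weight p + weight q
weight-⊕ []           []           = refl
weight-⊕ (true ∷ p)   (true ∷ q)   = begin
  weight (p ⊕ q) + 2 * suc (weight (p ∩ q))   ≡⟨ shift (weight (p ⊕ q)) (weight (p ∩ q)) ⟩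
  2 + (weight (p ⊕ q) + 2 * weight (p ∩ q))   ≡⟨ cong (2 +_) (weight-⊕ p q) ⟩
  2 + (weight p + weight q)                   ≡⟨ cong suc (+-suc (weight p) (weight q)) ⟨
  suc (weight p) + suc (weight q)             ∎
  where
  open ≡-Reasoning
  shift : ∀ w c → w + 2 * suc c ≡ 2 + (w + 2 * c)
  shift = solve-∀
weight-⊕ (true ∷ p)   (false ∷ q)  = cong suc (weight-⊕ p q)
weight-⊕ (false ∷ p)  (true ∷ q)   = trans (cong suc (weight-⊕ p q)) (sym (+-suc (weight p) (weight q)))
weight-⊕ (false ∷ p)  (false ∷ q)  = weight-⊕ p q

weight-⊕-disjoint : ∀ {m} (p q : Subset m) → Disjoint p q → weight (p ⊕ q) ≡ weight p + weight q
weight-⊕-disjoint {m} p q p∩q≡∅ = begin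
  weight (p ⊕ q)                      ≡⟨ +-identityʳ (weight (p ⊕ q)) ⟨
  weight (p ⊕ q) + 2 * 0              ≡⟨ cong (λ k → weight (p ⊕ q) + 2 * k) (∣⊥∣≡0 m) ⟨
  weight (p ⊕ q) + 2 * weight (∅ {m}) ≡⟨ cong (λ r → weight (p ⊕ q) + 2 * weight r) p∩q≡∅ ⟨
  weight (p ⊕ q) + 2 * weight (p ∩ q) ≡⟨ weight-⊕ p q ⟩
  weight p + weight q                 ∎
  where open ≡-Reasoning

weight-∩-⊕ : ∀ {m} (r p q : Subset m) → Disjoint p q → weight (r ∩ (p ⊕ q)) ≡ weight (r ∩ p) + weight (r ∩ q)
weight-∩-⊕ r p q p∩q≡∅ = trans (cong weight (∩-distribˡ-⊕ r p q))
  (weight-⊕-disjoint (r ∩ p) (r ∩ q) (⊑-disjoint (p∩q⊑q r p) (p∩q⊑q r q) p∩q≡∅))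

weight≡0⇒≡∅ : ∀ {m} (p : Subset m) → weight p ≡ 0 → p ≡ ∅
weight≡0⇒≡∅ []          _         = refl
weight≡0⇒≡∅ (false ∷ p) weight≡0  = cong (false ∷_) (weight≡0⇒≡∅ p weight≡0)

weight≡suc⇒≢∅ : ∀ {m k} {p : Subset m} → weight p ≡ suc k → p ≢ ∅
weight≡suc⇒≢∅ {m} ∣p∣≡1+k refl = contradiction (trans (sym (∣⊥∣≡0 m)) ∣p∣≡1+k) λ ()

subset-of-weight : ∀ {k m} → k ≤ m → ∃[ p ] weight {m} p ≡ k
subset-of-weight {zero}  {m}     _         = ∅ , ∣⊥∣≡0 m
subset-of-weight {suc k} {suc m} (s≤s k≤m) = let (p , ∣p∣≡k) = subset-of-weight k≤m in true ∷ p , cong suc ∣p∣≡k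

-- Sums over pairs and the Plotkin bound

distance : ∀ {m} → Subset m → Subset m → ℕ
distance p q = weight (p ⊕ q)

pairSum : ∀ {A : Set} → (A → A → ℕ) → List A → ℕ
pairSum f []       = 0
pairSum f (x ∷ xs) = sum (map (f x) xs) + pairSum f xs

module _ {A : Set} where

  open CommutativeSemigroupProperties +-commutativeSemigroup using () renaming (interchange to +-interchange)

  sum-map-split : {f g h : A → ℕ} → (∀ y → f y ≡ g y + h y) → ∀ ys →
                  sum (map f ys) ≡ sum (map g ys) + sum (map h ys)
  sum-map-split f≡g+h []       = refl
  sum-map-split {f} {g} {h} f≡g+h (y ∷ ys) =
    trans (cong₂ _+_ (f≡g+h y) (sum-map-split {f} {g} {h} f≡g+h ys))
          (+-interchange (g y) (h y) (sum (map g ys)) (sum (map h ys)))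

  sum-map-mono : {f g : A → ℕ} {ys : List A} → All (λ y → f y ≤ g y) ys → sum (map f ys) ≤ sum (map g ys)
  sum-map-mono []           = z≤n
  sum-map-mono (fy≤gy ∷ ps) = +-mono-≤ fy≤gy (sum-map-mono ps)

  pairSum-split : {f g h : A → A → ℕ} → (∀ x y → f x y ≡ g x y + h x y) → ∀ xs →
                  pairSum f xs ≡ pairSum g xs + pairSum h xs
  pairSum-split f≡g+h []       = refl
  pairSum-split {f} {g} {h} f≡g+h (x ∷ xs) =
    trans (cong₂ _+_ (sum-map-split {f x} {g x} {h x} (f≡g+h x) xs) (pairSum-split {f} {g} {h} f≡g+h xs))
          (+-interchange (sum (map (g x) xs)) (sum (map (h x) xs)) (pairSum g xs) (pairSum h xs))

  pairSum-mono : {f g : A → A → ℕ} {xs : List A} → AllPairs (λ x y → f x y ≤ g x y) xs →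
                 pairSum f xs ≤ pairSum g xs
  pairSum-mono []                 = z≤n
  pairSum-mono (fx≤gx ∷ fxs≤gxs) = +-mono-≤ (sum-map-mono fx≤gx) (pairSum-mono fxs≤gxs)

  pairSum-map : ∀ {B : Set} (f : B → B → ℕ) (h : A → B) xs →
                pairSum f (map h xs) ≡ pairSum (λ x y → f (h x) (h y)) xs
  pairSum-map f h []       = refl
  pairSum-map f h (x ∷ xs) = cong₂ _+_ (cong sum (sym (map-∘ xs))) (pairSum-map f h xs)

  sum-map-zero : {f : A → ℕ} → (∀ y → f y ≡ 0) → ∀ ys → sum (map f ys) ≡ 0
  sum-map-zero f≡0 []       = refl
  sum-map-zero f≡0 (y ∷ ys) = cong₂ _+_ (f≡0 y) (sum-map-zero f≡0 ys)

  pairSum-zero : {f : A → A → ℕ} → (∀ x y → f x y ≡ 0) → ∀ xs → pairSum f xs ≡ 0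
  pairSum-zero f≡0 []       = refl
  pairSum-zero f≡0 (x ∷ xs) = cong₂ _+_ (sum-map-zero (f≡0 x) xs) (pairSum-zero f≡0 xs)

4m[m+d]≤[2m+d]² : ∀ m d → 4 * (m * (m + d)) ≤ (m + (m + d)) * (m + (m + d))
4m[m+d]≤[2m+d]² m d = subst (4 * (m * (m + d)) ≤_) (sym (square m d)) (m≤m+n _ (d * d))
  where
  square : ∀ m d → (m + (m + d)) * (m + (m + d)) ≡ 4 * (m * (m + d)) + d * d
  square = solve-∀

4mn≤[m+n]² : ∀ m n → 4 * (m * n) ≤ (m + n) * (m + n)
4mn≤[m+n]² m n with ≤-total m n
... | inj₁ m≤n = let (d , m+d≡n) = m≤n⇒∃[o]m+o≡n m≤n in
  subst (λ k → 4 * (m * k) ≤ (m + k) * (m + k)) m+d≡n (4m[m+d]≤[2m+d]² m d)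
... | inj₂ n≤m = let (d , n+d≡m) = m≤n⇒∃[o]m+o≡n n≤m in
  subst (λ k → 4 * (k * n) ≤ (k + n) * (k + n)) n+d≡m
    (subst₂ _≤_ (cong (4 *_) (*-comm n (n + d))) (*-cong (+-comm n (n + d))) (4m[m+d]≤[2m+d]² n d))
  where
  *-cong : ∀ {a b} → a ≡ b → a * a ≡ b * b
  *-cong a≡b = cong₂ _*_ a≡b a≡b

m*n≤[m+n]²/4 : ∀ m n → m * n ≤ (m + n) * (m + n) / 4
m*n≤[m+n]²/4 m n = begin
  m * n                  ≡⟨ m*n/n≡m (m * n) 4 ⟨
  m * n * 4 / 4          ≤⟨ /-monoˡ-≤ 4 (subst (_≤ (m + n) * (m + n)) (*-comm 4 (m * n)) (4mn≤[m+n]² m n)) ⟩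
  (m + n) * (m + n) / 4  ∎
  where open ≤-Reasoning

bitDistance : Bool → Bool → ℕ
bitDistance a b = if a xor b then 1 else 0

distance-∷ : ∀ {m} (p q : Subset (suc m)) → distance p q ≡ bitDistance (head p) (head q) + distance (tail p) (tail q)
distance-∷ (true ∷ p)  (true ∷ q)  = refl
distance-∷ (true ∷ p)  (false ∷ q) = refl
distance-∷ (false ∷ p) (true ∷ q)  = refl
distance-∷ (false ∷ p) (false ∷ q) = refl

pairSum-distance-∷ : ∀ {m} (ps : List (Subset (suc m))) →
  pairSum distance ps ≡ pairSum bitDistance (map head ps) + pairSum distance (map tail ps)
pairSum-distance-∷ ps = trans (pairSum-split distance-∷ ps)
  (sym (cong₂ _+_ (pairSum-map bitDistance head ps) (pairSum-map distance tail ps)))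

trues falses : List Bool → ℕ
trues []           = 0
trues (true ∷ bs)  = suc (trues bs)
trues (false ∷ bs) = trues bs
falses []           = 0
falses (true ∷ bs)  = falses bs
falses (false ∷ bs) = suc (falses bs)

trues+falses≡length : ∀ bs → trues bs + falses bs ≡ length bs
trues+falses≡length []           = refl
trues+falses≡length (true ∷ bs)  = cong suc (trues+falses≡length bs)
trues+falses≡length (false ∷ bs) = trans (+-suc (trues bs) (falses bs)) (cong suc (trues+falses≡length bs))

sum-map-bitDistance-true : ∀ bs → sum (map (bitDistance true) bs) ≡ falses bs
sum-map-bitDistance-true []           = refl
sum-map-bitDistance-true (true ∷ bs)  = sum-map-bitDistance-true bs
sum-map-bitDistance-true (false ∷ bs) = cong suc (sum-map-bitDistance-true bs)

sum-map-bitDistance-false : ∀ bs → sum (map (bitDistance false) bs) ≡ trues bs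
sum-map-bitDistance-false []           = refl
sum-map-bitDistance-false (true ∷ bs)  = cong suc (sum-map-bitDistance-false bs)
sum-map-bitDistance-false (false ∷ bs) = sum-map-bitDistance-false bs

pairSum-bitDistance : ∀ bs → pairSum bitDistance bs ≡ trues bs * falses bs
pairSum-bitDistance []           = refl
pairSum-bitDistance (true ∷ bs)  = cong₂ _+_ (sum-map-bitDistance-true bs) (pairSum-bitDistance bs)
pairSum-bitDistance (false ∷ bs) =
  trans (cong₂ _+_ (sum-map-bitDistance-false bs) (pairSum-bitDistance bs)) (sym (*-suc (trues bs) (falses bs)))

all-false⇒trues≡0 : ∀ {bs} → All (_≡ false) bs → trues bs ≡ 0
all-false⇒trues≡0 []          = refl
all-false⇒trues≡0 (refl ∷ ps) = all-false⇒trues≡0 ps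

pairSum-bitDistance-≤ : ∀ bs → pairSum bitDistance bs ≤ length bs * length bs / 4
pairSum-bitDistance-≤ bs = begin
  pairSum bitDistance bs                              ≡⟨ pairSum-bitDistance bs ⟩
  trues bs * falses bs                                ≤⟨ m*n≤[m+n]²/4 (trues bs) (falses bs) ⟩
  (trues bs + falses bs) * (trues bs + falses bs) / 4 ≡⟨ cong (λ k → k * k / 4) (trues+falses≡length bs) ⟩
  length bs * length bs / 4                           ∎
  where open ≤-Reasoning

tail-⊑ : ∀ {m b} {z : Subset m} (p : Subset (suc m)) → p ⊑ (b ∷ z) → tail p ⊑ z
tail-⊑ (a ∷ p) p⊑b∷z = cong tail p⊑b∷z

head-⊑-false : ∀ {m} {z : Subset m} (p : Subset (suc m)) → p ⊑ (false ∷ z) → head p ≡ false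
head-⊑-false (false ∷ p) _ = refl
head-⊑-false (true ∷ p) ()

-- A coordinate of z at which t of the k words have a 1 contributes t (k − t) ≤ ⌊k²/4⌋ to the sum.
plotkin : ∀ {m} (z : Subset m) (ps : List (Subset m)) → All (_⊑ z) ps →
          pairSum distance ps ≤ length ps * length ps / 4 * weight z
plotkin [] ps _ = subst (_≤ length ps * length ps / 4 * 0) (sym (pairSum-zero (λ { [] [] → refl }) ps)) z≤n
plotkin (b ∷ z) ps ps⊑b∷z = begin
  pairSum distance ps                                              ≡⟨ pairSum-distance-∷ ps ⟩
  pairSum bitDistance (map head ps) + pairSum distance (map tail ps) ≤⟨ +-mono-≤ (column b ps⊑b∷z) tails ⟩
  (if b then k * k / 4 else 0) + k * k / 4 * weight z              ≡⟨ total b ⟩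
  k * k / 4 * weight (b ∷ z)                                       ∎
  where
  open ≤-Reasoning
  k = length ps
  tails : pairSum distance (map tail ps) ≤ k * k / 4 * weight z
  tails = subst (λ l → pairSum distance (map tail ps) ≤ l * l / 4 * weight z) (length-map tail ps)
            (plotkin z (map tail ps) (All-map⁺ (All.map (λ {p} → tail-⊑ p) ps⊑b∷z)))
  column : ∀ b → All (_⊑ (b ∷ z)) ps → pairSum bitDistance (map head ps) ≤ (if b then k * k / 4 else 0)
  column true  _ = subst (λ l → pairSum bitDistance (map head ps) ≤ l * l / 4) (length-map head ps)
                     (pairSum-bitDistance-≤ (map head ps))
  column false ps⊑false∷z = ≤-reflexive (begin-equality
    pairSum bitDistance (map head ps)                 ≡⟨ pairSum-bitDistance (map head ps) ⟩
    trues (map head ps) * falses (map head ps)        ≡⟨ cong (_* falses (map head ps)) (all-false⇒trues≡0 heads≡false) ⟩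
    0                                                 ∎)
    where
    heads≡false : All (_≡ false) (map head ps)
    heads≡false = All-map⁺ (All.map (λ {p} → head-⊑-false p) ps⊑false∷z)
  total : ∀ b → (if b then k * k / 4 else 0) + k * k / 4 * weight z ≡ k * k / 4 * weight (b ∷ z)
  total true  = sym (*-suc (k * k / 4) (weight z))
  total false = refl

plotkin-spread : ∀ {m} δ (z : Subset m) (ps : List (Subset m)) → All (_⊑ z) ps →
                 AllPairs (λ p q → δ ≤ distance p q) ps →
                 pairSum (λ _ _ → δ) ps ≤ length ps * length ps / 4 * weight z
plotkin-spread δ z ps ps⊑z spread = ≤-trans (pairSum-mono spread) (plotkin z ps ps⊑z)

-- Pigeonhole and Ramsey for lists

module _ {A : Set} where

  length-filter-∁ : ∀ {P : A → Set} (P? : Decidable P) xs →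
                    length (filter P? xs) + length (filter (∁? P?) xs) ≡ length xs
  length-filter-∁ P? []       = refl
  length-filter-∁ P? (x ∷ xs) with P? x
  ... | yes _ = cong suc (length-filter-∁ P? xs)
  ... | no  _ = trans (+-suc _ _) (cong suc (length-filter-∁ P? xs))

  AllPairs-resp-⊆ : ∀ {R : A → A → Set} {xs ys} → xs ⊆ ys → AllPairs R ys → AllPairs R xs
  AllPairs-resp-⊆ []         []          = []
  AllPairs-resp-⊆ (y ∷ʳ τ)   (_ ∷ rys)   = AllPairs-resp-⊆ τ rys
  AllPairs-resp-⊆ (refl ∷ τ) (ry ∷ rys)  = All-resp-⊆ τ ry ∷ AllPairs-resp-⊆ τ rys

a+a<b+c⇒a<b⊎a<c : ∀ a b c → a + a < b + c → a < b ⊎ a < c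
a+a<b+c⇒a<b⊎a<c a b c a+a<b+c with a <? b
... | yes a<b = inj₁ a<b
... | no  a≮b = inj₂ (+-cancelˡ-< a a c (<-≤-trans a+a<b+c (+-monoˡ-≤ c (≮⇒≥ a≮b))))

pigeonhole : ∀ {A : Set} m r (key : A → Vec Bool m) xs → r * 2 ^ m < length xs →
             ∃[ κ ] ∃[ ys ] ys ⊆ xs × All (λ y → key y ≡ κ) ys × r < length ys
pigeonhole zero r key xs r<xs =
  [] , xs , ⊆-refl , All.universal (λ y → Vec-0 (key y)) xs , subst (_< length xs) (*-identityʳ r) r<xs
  where
  Vec-0 : (v : Vec Bool 0) → v ≡ []
  Vec-0 [] = refl
pigeonhole {A} (suc m) r key xs r<xs =
  [ extend true  (filter H? xs) (filter-⊆ H? xs) (all-filter H? xs)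
  , extend false (filter (∁? H?) xs) (filter-⊆ (∁? H?) xs) (All.map ¬-not (all-filter (∁? H?) xs))
  ]′ (a+a<b+c⇒a<b⊎a<c (r * 2 ^ m) _ _ (subst₂ _<_ (double r (2 ^ m)) (sym (length-filter-∁ H? xs)) r<xs))
  where
  H? : Decidable (λ y → head (key y) ≡ true)
  H? y = head (key y) ≟ᵇ true
  double : ∀ r q → r * (2 * q) ≡ r * q + r * q
  double = solve-∀
  head-tail≡ : ∀ {b κ} (v : Vec Bool (suc m)) → head v ≡ b → tail v ≡ κ → v ≡ b ∷ κ
  head-tail≡ (_ ∷ _) refl refl = refl
  extend : ∀ b zs → zs ⊆ xs → All (λ y → head (key y) ≡ b) zs → r * 2 ^ m < length zs →
           ∃[ κ ] ∃[ ys ] ys ⊆ xs × All (λ y → key y ≡ κ) ys × r < length ys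
  extend b zs zs⊆xs heads r<zs with pigeonhole m r (λ y → tail (key y)) zs r<zs
  ... | κ , ys , ys⊆zs , tails , r<ys =
    b ∷ κ , ys , ⊆-trans ys⊆zs zs⊆xs ,
    All.zipWith (λ {y} (h , t) → head-tail≡ (key y) h t) (All-resp-⊆ ys⊆zs heads , tails) , r<ys

-- The Erdős–Szekeres bound (s + t choose s) on the Ramsey number R(s + 1, t + 1).
ramseyBound : ℕ → ℕ → ℕ
ramseyBound zero    t       = 1
ramseyBound (suc s) zero    = 1
ramseyBound (suc s) (suc t) = ramseyBound s (suc t) + ramseyBound (suc s) t

0<ramseyBound : ∀ s t → 0 < ramseyBound s t
0<ramseyBound zero    t       = s≤s z≤n
0<ramseyBound (suc s) zero    = s≤s z≤n
0<ramseyBound (suc s) (suc t) = <-≤-trans (0<ramseyBound s (suc t)) (m≤m+n _ _)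

Clique : ∀ {A : Set} → (A → A → Set) → ℕ → List A → Set
Clique E k xs = ∃[ ys ] ys ⊆ xs × AllPairs E ys × length ys ≡ k

module _ {A : Set} {R : A → A → Set} (R? : ∀ x y → Dec (R x y)) where

  ramsey : ∀ s t xs → ramseyBound s t ≤ length xs →
           Clique R (suc s) xs ⊎ Clique (λ x y → ¬ R x y) (suc t) xs
  ramsey zero    t       (x ∷ xs) _ = inj₁ (x ∷ [] , refl ∷ minimum xs , [] ∷ [] , refl)
  ramsey (suc s) zero    (x ∷ xs) _ = inj₂ (x ∷ [] , refl ∷ minimum xs , [] ∷ [] , refl)
  ramsey (suc s) (suc t) []       bound = contradiction bound (<⇒≱ (0<ramseyBound (suc s) (suc t)))
  ramsey (suc s) (suc t) (x ∷ xs) bound with ramseyBound s (suc t) ≤? length (filter (R? x) xs)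
  ... | yes enough-related with ramsey s (suc t) (filter (R? x) xs) enough-related
  ...   | inj₁ (ys , τ , Rys , l) =
          inj₁ (x ∷ ys , refl ∷ ⊆-trans τ (filter-⊆ (R? x) xs) ,
                All-resp-⊆ τ (all-filter (R? x) xs) ∷ Rys , cong suc l)
  ...   | inj₂ (ys , τ , ¬Rys , l) = inj₂ (ys , x ∷ʳ ⊆-trans τ (filter-⊆ (R? x) xs) , ¬Rys , l)
  ramsey (suc s) (suc t) (x ∷ xs) bound | no few-related
    with ramsey (suc s) t (filter (∁? (R? x)) xs) enough-unrelated
    where
    enough-unrelated : ramseyBound (suc s) t ≤ length (filter (∁? (R? x)) xs)
    enough-unrelated = +-cancelˡ-≤ (length (filter (R? x) xs)) _ _ (≤-pred (begin
      suc (length (filter (R? x) xs) + ramseyBound (suc s) t) ≤⟨ +-monoˡ-≤ _ (≰⇒> few-related) ⟩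
      ramseyBound s (suc t) + ramseyBound (suc s) t         ≤⟨ bound ⟩
      suc (length xs)                                        ≡⟨ cong suc (length-filter-∁ (R? x) xs) ⟨
      suc (length (filter (R? x) xs) + length (filter (∁? (R? x)) xs)) ∎))
      where open ≤-Reasoning
  ... | inj₁ (ys , τ , Rys , l) = inj₁ (ys , x ∷ʳ ⊆-trans τ (filter-⊆ (∁? (R? x)) xs) , Rys , l)
  ... | inj₂ (ys , τ , ¬Rys , l) =
          inj₂ (x ∷ ys , refl ∷ ⊆-trans τ (filter-⊆ (∁? (R? x)) xs) ,
                All-resp-⊆ τ (all-filter (∁? (R? x)) xs) ∷ ¬Rys , cong suc l)

module _ {A : Set} (_≟_ : DecidableEquality A) where

  open DecMembership _≟_ using (_∈?_)

  private
    length≤1 : ∀ {f} {xs : List A} → Unique xs → All (_≡ f) xs → length xs ≤ 1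
    length≤1 []                      _                       = z≤n
    length≤1 (_ ∷ [])                _                       = s≤s z≤n
    length≤1 ((x≢y ∷ _) ∷ _ ∷ _)     (refl ∷ refl ∷ _)       = contradiction refl x≢y

  Unique-length-≤ : ∀ {ys} F → Unique ys → All (_∈ F) ys → length ys ≤ length F
  Unique-length-≤ {[]}    []      _   _         = z≤n
  Unique-length-≤ {_ ∷ _} []      _   (() ∷ _)
  Unique-length-≤ {ys}    (f ∷ F) ys! ys⊆f∷F    = begin
    length ys                                                 ≡⟨ length-filter-∁ (_≟ f) ys ⟨
    length (filter (_≟ f) ys) + length (filter (∁? (_≟ f)) ys) ≤⟨ +-mono-≤ copies-of-f rest ⟩
    1 + length F                                              ∎
    where
    open ≤-Reasoning
    copies-of-f : length (filter (_≟ f) ys) ≤ 1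
    copies-of-f = length≤1 (Unique.filter⁺ (_≟ f) ys!) (all-filter (_≟ f) ys)
    in-F : ∀ {y} → y ∈ f ∷ F → y ≢ f → y ∈ F
    in-F (here y≡f)  y≢f = contradiction y≡f y≢f
    in-F (there y∈F) _   = y∈F
    rest : length (filter (∁? (_≟ f)) ys) ≤ length F
    rest = Unique-length-≤ F (Unique.filter⁺ (∁? (_≟ f)) ys!)
             (All.zipWith (λ (y∈f∷F , y≢f) → in-F y∈f∷F y≢f)
               (All-resp-⊆ (filter-⊆ (∁? (_≟ f)) ys) ys⊆f∷F , all-filter (∁? (_≟ f)) ys))

  longer⇒∃∉ : ∀ {ys} F → Unique ys → length F < length ys → ∃[ y ] y ∈ ys × y ∉ F
  longer⇒∃∉ {ys} F ys! F<ys with All.all? (_∈? F) ys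
  ... | yes ys⊆F = contradiction (Unique-length-≤ F ys! ys⊆F) (<⇒≱ F<ys)
  ... | no  ys⊈F = find (¬All⇒Any¬ (_∈? F) ys ys⊈F)

Unique-lookup-injective : ∀ {A : Set} {xs : List A} → Unique xs → ∀ i j → lookup xs i ≡ lookup xs j → i ≡ j
Unique-lookup-injective {xs = x ∷ xs} _           zero    zero    _  = refl
Unique-lookup-injective {xs = x ∷ xs} (x∉xs ∷ _)  zero    (suc j) eq = contradiction eq (All.lookup x∉xs (∈-lookup j))
Unique-lookup-injective {xs = x ∷ xs} (x∉xs ∷ _)  (suc i) zero    eq = contradiction (sym eq) (All.lookup x∉xs (∈-lookup i))
Unique-lookup-injective {xs = x ∷ xs} (_ ∷ xs!)   (suc i) (suc j) eq = cong suc (Unique-lookup-injective xs! i j eq)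

length≡3⇒triple : ∀ {A : Set} (xs : List A) → length xs ≡ 3 → ∃[ x ] ∃[ y ] ∃[ z ] xs ≡ x ∷ y ∷ z ∷ []
length≡3⇒triple (x ∷ y ∷ z ∷ []) _ = x , y , z , refl

Unique-false∷-++-true∷ : ∀ {m} {xs ys : List (Subset m)} → Unique xs → Unique ys →
                         Unique (map (false ∷_) xs ++ map (true ∷_) ys)
Unique-false∷-++-true∷ xs! ys! = Unique.++⁺ (Unique.map⁺ ∷-injectiveʳ xs!) (Unique.map⁺ ∷-injectiveʳ ys!) apart
  where
  apart : ∀ {v} → ¬ (v ∈ map (false ∷_) _ × v ∈ map (true ∷_) _)
  apart (v∈fs , v∈ts) with ∈-map⁻ (false ∷_) v∈fs | ∈-map⁻ (true ∷_) v∈ts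
  ... | _ , _ , refl | _ , _ , ()

subsetsOf : ∀ {m} → Subset m → List (Subset m)
subsetsOf []          = [] ∷ []
subsetsOf (false ∷ z) = map (false ∷_) (subsetsOf z)
subsetsOf (true ∷ z)  = map (false ∷_) (subsetsOf z) ++ map (true ∷_) (subsetsOf z)

length-subsetsOf : ∀ {m} (z : Subset m) → length (subsetsOf z) ≡ 2 ^ weight z
length-subsetsOf []          = refl
length-subsetsOf (false ∷ z) = trans (length-map (false ∷_) (subsetsOf z)) (length-subsetsOf z)
length-subsetsOf (true ∷ z)  = begin
  length (map (false ∷_) (subsetsOf z) ++ map (true ∷_) (subsetsOf z))
    ≡⟨ length-++ (map (false ∷_) (subsetsOf z)) ⟩
  length (map (false ∷_) (subsetsOf z)) + length (map (true ∷_) (subsetsOf z))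
    ≡⟨ cong₂ _+_ (length-map (false ∷_) (subsetsOf z)) (length-map (true ∷_) (subsetsOf z)) ⟩
  length (subsetsOf z) + length (subsetsOf z)
    ≡⟨ cong₂ _+_ (length-subsetsOf z) (length-subsetsOf z) ⟩
  2 ^ weight z + 2 ^ weight z
    ≡⟨ cong (2 ^ weight z +_) (+-identityʳ (2 ^ weight z)) ⟨
  2 ^ suc (weight z)
    ∎
  where open ≡-Reasoning

subsetsOf-unique : ∀ {m} (z : Subset m) → Unique (subsetsOf z)
subsetsOf-unique []          = [] ∷ []
subsetsOf-unique (false ∷ z) = Unique.map⁺ ∷-injectiveʳ (subsetsOf-unique z)
subsetsOf-unique (true ∷ z)  = Unique-false∷-++-true∷ (subsetsOf-unique z) (subsetsOf-unique z)

subsetsOf-⊑ : ∀ {m} (z : Subset m) → All (_⊑ z) (subsetsOf z)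
subsetsOf-⊑ []          = refl ∷ []
subsetsOf-⊑ (false ∷ z) = All-map⁺ (All.map (cong (false ∷_)) (subsetsOf-⊑ z))
subsetsOf-⊑ (true ∷ z)  = All-++⁺ (All-map⁺ (All.map (cong (false ∷_)) (subsetsOf-⊑ z)))
                                  (All-map⁺ (All.map (cong (true ∷_)) (subsetsOf-⊑ z)))

subsetsOfSize : ℕ → (m : ℕ) → List (Subset m)
subsetsOfSize zero    m       = ∅ ∷ []
subsetsOfSize (suc k) zero    = []
subsetsOfSize (suc k) (suc m) = map (false ∷_) (subsetsOfSize (suc k) m) ++ map (true ∷_) (subsetsOfSize k m)

length-subsetsOfSize : ∀ k m → length (subsetsOfSize k m) ≡ m C k
length-subsetsOfSize zero    m       = refl
length-subsetsOfSize (suc k) zero    = refl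
length-subsetsOfSize (suc k) (suc m) = begin
  length (map (false ∷_) (subsetsOfSize (suc k) m) ++ map (true ∷_) (subsetsOfSize k m))
    ≡⟨ length-++ (map (false ∷_) (subsetsOfSize (suc k) m)) ⟩
  length (map (false ∷_) (subsetsOfSize (suc k) m)) + length (map (true ∷_) (subsetsOfSize k m))
    ≡⟨ cong₂ _+_ (length-map (false ∷_) (subsetsOfSize (suc k) m)) (length-map (true ∷_) (subsetsOfSize k m)) ⟩
  length (subsetsOfSize (suc k) m) + length (subsetsOfSize k m)
    ≡⟨ cong₂ _+_ (length-subsetsOfSize (suc k) m) (length-subsetsOfSize k m) ⟩
  m C suc k + m C k  ≡⟨ +-comm (m C suc k) (m C k) ⟩
  m C k + m C suc k  ≡⟨ nCk+nC[k+1]≡[n+1]C[k+1] m k ⟩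
  suc m C suc k      ∎
  where open ≡-Reasoning

subsetsOfSize-unique : ∀ k m → Unique (subsetsOfSize k m)
subsetsOfSize-unique zero    m       = [] ∷ []
subsetsOfSize-unique (suc k) zero    = []
subsetsOfSize-unique (suc k) (suc m) = Unique-false∷-++-true∷ (subsetsOfSize-unique (suc k) m) (subsetsOfSize-unique k m)

subsetsOfSize-weight : ∀ k m → All (λ p → weight p ≡ k) (subsetsOfSize k m)
subsetsOfSize-weight zero    m       = ∣⊥∣≡0 m ∷ []
subsetsOfSize-weight (suc k) zero    = []
subsetsOfSize-weight (suc k) (suc m) = All-++⁺ (All-map⁺ (subsetsOfSize-weight (suc k) m))
                                                (All-map⁺ (All.map (cong suc) (subsetsOfSize-weight k m)))

-- Subset sums in F₂ⁿ

module _ {A : Set} where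

  select : (xs : List A) → Subset (length xs) → List A
  select []       []          = []
  select (x ∷ xs) (true ∷ p)  = x ∷ select xs p
  select (x ∷ xs) (false ∷ p) = select xs p

  select-⊆ : ∀ xs p → select xs p ⊆ xs
  select-⊆ []       []          = []
  select-⊆ (x ∷ xs) (true ∷ p)  = refl ∷ select-⊆ xs p
  select-⊆ (x ∷ xs) (false ∷ p) = x ∷ʳ select-⊆ xs p

  length-select : ∀ xs p → length (select xs p) ≡ weight p
  length-select []       []          = refl
  length-select (x ∷ xs) (true ∷ p)  = cong suc (length-select xs p)
  length-select (x ∷ xs) (false ∷ p) = length-select xs p

  select-disjoint : ∀ {xs} p q {y} → Unique xs → Disjoint p q → y ∈ select xs p → y ∈ select xs q → ⊥
  select-disjoint {[]}     []          []          _ _ () _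
  select-disjoint {x ∷ xs} (true ∷ p)  (true ∷ q)  _ () _ _
  select-disjoint {x ∷ xs} (true ∷ p) (false ∷ q) (x∉xs ∷ _) _ (here refl) y∈q =
    All.lookup x∉xs (Any-resp-⊆ (select-⊆ xs q) y∈q) refl
  select-disjoint {x ∷ xs} (false ∷ p) (true ∷ q) (x∉xs ∷ _) _ y∈p (here refl) =
    All.lookup x∉xs (Any-resp-⊆ (select-⊆ xs p) y∈p) refl
  select-disjoint {x ∷ xs} (true ∷ p)  (false ∷ q) (_ ∷ xs!) p∩q≡∅ (there y∈p) y∈q =
    select-disjoint p q xs! (∷-injectiveʳ p∩q≡∅) y∈p y∈q
  select-disjoint {x ∷ xs} (false ∷ p) (true ∷ q)  (_ ∷ xs!) p∩q≡∅ y∈p (there y∈q) =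
    select-disjoint p q xs! (∷-injectiveʳ p∩q≡∅) y∈p y∈q
  select-disjoint {x ∷ xs} (false ∷ p) (false ∷ q) (_ ∷ xs!) p∩q≡∅ y∈p y∈q =
    select-disjoint p q xs! (∷-injectiveʳ p∩q≡∅) y∈p y∈q

  indicator : ∀ {P : A → Set} → Decidable P → (xs : List A) → Subset (length xs)
  indicator P? []       = []
  indicator P? (x ∷ xs) = does (P? x) ∷ indicator P? xs

  select-indicator : ∀ {P : A → Set} (P? : Decidable P) xs → select xs (indicator P? xs) ≡ filter P? xs
  select-indicator P? []       = refl
  select-indicator P? (x ∷ xs) with does (P? x)
  ... | true  = cong (x ∷_) (select-indicator P? xs)
  ... | false = select-indicator P? xs

⨁ : ∀ {n} → List (F₂^ n) → F₂^ n
⨁ = foldr _⊕_ ∅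

⨁-↭ : ∀ {n} {xs ys : List (F₂^ n)} → xs ↭ ys → ⨁ xs ≡ ⨁ ys
⨁-↭ Perm.refl         = refl
⨁-↭ (Perm.prep x p)   = cong (x ⊕_) (⨁-↭ p)
⨁-↭ (Perm.swap x y p) = trans (cong (λ s → x ⊕ (y ⊕ s)) (⨁-↭ p)) (⊕-exchangeˡ x y _)
⨁-↭ (Perm.trans p q)  = trans (⨁-↭ p) (⨁-↭ q)

subsetSum : ∀ {A : Set} {n} → (A → F₂^ n) → (xs : List A) → Subset (length xs) → F₂^ n
subsetSum f xs p = ⨁ (map f (select xs p))

subsetSum-⊕ : ∀ {A : Set} {n} (f : A → F₂^ n) xs p q →
              subsetSum f xs (p ⊕ q) ≡ subsetSum f xs p ⊕ subsetSum f xs q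
subsetSum-⊕ f []       []          []          = sym (⊕-identityʳ ∅)
subsetSum-⊕ f (x ∷ xs) (true ∷ p)  (true ∷ q)  = begin
  subsetSum f xs (p ⊕ q)                                  ≡⟨ subsetSum-⊕ f xs p q ⟩
  subsetSum f xs p ⊕ subsetSum f xs q                     ≡⟨ ⊕-identityˡ _ ⟨
  ∅ ⊕ (subsetSum f xs p ⊕ subsetSum f xs q)               ≡⟨ cong (_⊕ _) (p≡q⇒p⊕q≡∅ {x = f x} refl) ⟨
  (f x ⊕ f x) ⊕ (subsetSum f xs p ⊕ subsetSum f xs q)     ≡⟨ ⊕-interchange (f x) (f x) _ _ ⟩
  (f x ⊕ subsetSum f xs p) ⊕ (f x ⊕ subsetSum f xs q)     ∎
  where open ≡-Reasoning
subsetSum-⊕ f (x ∷ xs) (true ∷ p)  (false ∷ q) =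
  trans (cong (f x ⊕_) (subsetSum-⊕ f xs p q)) (sym (⊕-assoc (f x) _ _))
subsetSum-⊕ f (x ∷ xs) (false ∷ p) (true ∷ q)  =
  trans (cong (f x ⊕_) (subsetSum-⊕ f xs p q)) (⊕-exchangeˡ (f x) _ _)
subsetSum-⊕ f (x ∷ xs) (false ∷ p) (false ∷ q) = subsetSum-⊕ f xs p q

isOdd : ℕ → Bool
isOdd zero    = false
isOdd (suc k) = not (isOdd k)

⨁-lift : ∀ {n} (ys : List (F₂^ n)) → ⨁ (map (true ∷_) ys) ≡ isOdd (length ys) ∷ ⨁ ys
⨁-lift []       = refl
⨁-lift (y ∷ ys) = cong ((true ∷ y) ⊕_) (⨁-lift ys)

⨁-pair≢∅ : ∀ {n} (xs : List (F₂^ n)) → length xs ≡ 2 → Unique xs → ⨁ xs ≢ ∅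
⨁-pair≢∅ (a ∷ b ∷ []) _ ((a≢b ∷ []) ∷ _) a⊕b⊕∅≡∅ =
  a≢b (p⊕q≡∅⇒p≡q a b (trans (cong (a ⊕_) (sym (⊕-identityʳ b))) a⊕b⊕∅≡∅))

points : ∀ {n} → Triple n → List (F₂^ n)
points (x , y , z) = x ∷ y ∷ z ∷ []

⨁-points : ∀ {n} (T : Triple n) → let (x , y , z) = T in ⨁ (points T) ≡ x ⊕ y ⊕ z
⨁-points (x , y , z) = trans (cong (λ r → x ⊕ (y ⊕ r)) (⊕-identityʳ z)) (sym (⊕-assoc x y z))

∈T⇒∈ : ∀ {n} {v : F₂^ n} {T} → v ∈T T → v ∈ points T
∈T⇒∈ (inj₁ v≡x)        = here v≡x
∈T⇒∈ (inj₂ (inj₁ v≡y)) = there (here v≡y)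
∈T⇒∈ (inj₂ (inj₂ v≡z)) = there (there (here v≡z))

∈⇒∈T : ∀ {n} {v : F₂^ n} {T} → v ∈ points T → v ∈T T
∈⇒∈T (here v≡x)                 = inj₁ v≡x
∈⇒∈T (there (here v≡y))         = inj₂ (inj₁ v≡y)
∈⇒∈T (there (there (here v≡z))) = inj₂ (inj₂ v≡z)

_∈T?_ : ∀ {n} (v : F₂^ n) (T : Triple n) → Dec (v ∈T T)
v ∈T? (x , y , z) = v ≟ x ⊎-dec (v ≟ y ⊎-dec v ≟ z)
  where _≟_ = ≡-dec _≟ᵇ_

sum≡6⇒≡3 : ∀ {x y} → x + y ≡ 6 → x ≤ 3 → y ≤ 3 → x ≡ 3
sum≡6⇒≡3 {x} {y} x+y≡6 x≤3 y≤3 =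
  ≤-antisym x≤3 (+-cancelʳ-≤ 3 3 x (subst (_≤ x + 3) x+y≡6 (+-monoʳ-≤ x y≤3)))

m+m≢3 : ∀ m → m + m ≢ 3
m+m≢3 zero                ()
m+m≢3 (suc zero)          ()
m+m≢3 (suc (suc m)) eq =
  contradiction (subst (4 ≤_) eq (+-mono-≤ (m≤m+n 2 m) (m≤m+n 2 m))) λ { (s≤s (s≤s (s≤s ()))) }

sum≤18⇒all≡6 : ∀ {a b c} → 6 ≤ a → 6 ≤ b → 6 ≤ c → a + b + c ≤ 18 → a ≡ 6 × b ≡ 6 × c ≡ 6
sum≤18⇒all≡6 {a} {b} {c} 6≤a 6≤b 6≤c sum≤18 =
  ≤-antisym (≤6 (+-mono-≤ 6≤b 6≤c) (subst (_≤ 18) (+-assoc a b c) sum≤18)) 6≤a ,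
  ≤-antisym (≤6 (+-mono-≤ 6≤a 6≤c) (subst (_≤ 18) (regroup a b c) sum≤18)) 6≤b ,
  ≤-antisym (≤6 (+-mono-≤ 6≤a 6≤b) (subst (_≤ 18) (+-comm (a + b) c) sum≤18)) 6≤c
  where
  ≤6 : ∀ {x y} → 12 ≤ y → x + y ≤ 18 → x ≤ 6
  ≤6 {x} 12≤y x+y≤18 = +-cancelʳ-≤ 12 x 6 (≤-trans (+-monoʳ-≤ x 12≤y) x+y≤18)
  regroup : ∀ a b c → a + b + c ≡ b + (a + c)
  regroup = solve-∀

pair-sums≤3⇒total≢6 : ∀ a₀ a₁ a₂ a₃ → (a₀ + a₁) + (a₂ + a₃) ≡ 6 →
  a₀ + a₁ ≤ 3 → a₀ + a₂ ≤ 3 → a₀ + a₃ ≤ 3 → a₁ + a₂ ≤ 3 → a₁ + a₃ ≤ 3 → a₂ + a₃ ≤ 3 → ⊥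
pair-sums≤3⇒total≢6 a₀ a₁ a₂ a₃ total b₀₁ b₀₂ b₀₃ b₁₂ b₁₃ b₂₃ = m+m≢3 a₁ (begin
  a₁ + a₁   ≡⟨ cong (a₁ +_) (+-cancelˡ-≡ a₀ a₁ a₂ (trans e₀₁ (sym e₀₂))) ⟩
  a₁ + a₂   ≡⟨ e₁₂ ⟩
  3         ∎)
  where
  open ≡-Reasoning
  regroup₁ : ∀ a₀ a₁ a₂ a₃ → (a₀ + a₂) + (a₁ + a₃) ≡ (a₀ + a₁) + (a₂ + a₃)
  regroup₁ = solve-∀
  regroup₂ : ∀ a₀ a₁ a₂ a₃ → (a₁ + a₂) + (a₀ + a₃) ≡ (a₀ + a₁) + (a₂ + a₃)
  regroup₂ = solve-∀
  e₀₁ : a₀ + a₁ ≡ 3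
  e₀₁ = sum≡6⇒≡3 total b₀₁ b₂₃
  e₀₂ : a₀ + a₂ ≡ 3
  e₀₂ = sum≡6⇒≡3 (trans (regroup₁ a₀ a₁ a₂ a₃) total) b₀₂ b₁₃
  e₁₂ : a₁ + a₂ ≡ 3
  e₁₂ = sum≡6⇒≡3 (trans (regroup₂ a₀ a₁ a₂ a₃) total) b₁₂ b₀₃

module SidonCode {n} (S : FinSubset n) (sidon : Sidon S) where

  private
    L : List (F₂^ n)
    L = elems S

  s : ℕ
  s = ∣ S ∣

  Σ : Subset s → F₂^ n
  Σ p = ⨁ (select L p)

  key : Subset s → F₂^ (suc n)
  key = subsetSum (true ∷_) L

  key≡ : ∀ p → key p ≡ isOdd (weight p) ∷ Σ p
  key≡ p = trans (⨁-lift (select L p)) (cong (λ k → isOdd k ∷ Σ p) (length-select L p))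

  key-⊕ : ∀ p q → key (p ⊕ q) ≡ key p ⊕ key q
  key-⊕ = subsetSum-⊕ (true ∷_) L

  Σ-⊕ : ∀ p q → Σ (p ⊕ q) ≡ Σ p ⊕ Σ q
  Σ-⊕ p q = cong tail (trans (sym (key≡ (p ⊕ q))) (trans (key-⊕ p q) (cong₂ _⊕_ (key≡ p) (key≡ q))))

  Codeword : Subset s → Set
  Codeword c = key c ≡ ∅

  sameKey⇒codeword : ∀ {p q} → key p ≡ key q → Codeword (p ⊕ q)
  sameKey⇒codeword {p} {q} kp≡kq = trans (key-⊕ p q) (p≡q⇒p⊕q≡∅ kp≡kq)

  codeword-⊕ : ∀ {c d} → Codeword c → Codeword d → Codeword (c ⊕ d)
  codeword-⊕ {c} {d} c-code d-code =
    trans (key-⊕ c d) (trans (cong₂ _⊕_ c-code d-code) (⊕-identityˡ ∅))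

  codeword-even : ∀ {c} → Codeword c → isOdd (weight c) ≡ false
  codeword-even {c} c-code = cong head (trans (sym (key≡ c)) c-code)

  codeword-Σ≡∅ : ∀ {c} → Codeword c → Σ c ≡ ∅
  codeword-Σ≡∅ {c} c-code = cong tail (trans (sym (key≡ c)) c-code)

  select-unique : ∀ p → Unique (select L p)
  select-unique p = AllPairs-resp-⊆ (select-⊆ L p) (unique S)

  sidon-⨁-quadruple≢∅ : ∀ xs → xs ⊆ L → length xs ≡ 4 → Unique xs → ⨁ xs ≢ ∅
  sidon-⨁-quadruple≢∅ (a ∷ b ∷ c ∷ d ∷ []) xs⊆L _ ((a≢b ∷ a≢c ∷ _) ∷ (b≢c ∷ _) ∷ _) sum≡∅ =
    sidon a b c d (∈L (here refl)) (∈L (there (here refl))) (∈L (there (there (here refl))))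
      (∈L (there (there (there (here refl))))) (inj₁ (a≢b , a≢c , b≢c))
      (p⊕q≡∅⇒p≡q (a ⊕ b) (c ⊕ d) (begin
        (a ⊕ b) ⊕ (c ⊕ d)          ≡⟨ ⊕-assoc a b (c ⊕ d) ⟩
        a ⊕ (b ⊕ (c ⊕ d))          ≡⟨ cong (λ r → a ⊕ (b ⊕ (c ⊕ r))) (⊕-identityʳ d) ⟨
        a ⊕ (b ⊕ (c ⊕ (d ⊕ ∅)))    ≡⟨ sum≡∅ ⟩
        ∅                          ∎))
    where
    open ≡-Reasoning
    ∈L : ∀ {y} → y ∈ a ∷ b ∷ c ∷ d ∷ [] → y ∈S S
    ∈L = Any-resp-⊆ xs⊆L

  minimum-weight : ∀ {c} → Codeword c → c ≢ ∅ → 6 ≤ weight c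
  minimum-weight {c} c-code c≢∅ with weight c in eq
  ... | 0 = contradiction (weight≡0⇒≡∅ c eq) c≢∅
  ... | 1 = contradiction (trans (sym (cong isOdd eq)) (codeword-even c-code)) λ ()
  ... | 2 = contradiction (codeword-Σ≡∅ c-code) (⨁-pair≢∅ (select L c) (trans (length-select L c) eq) (select-unique c))
  ... | 3 = contradiction (trans (sym (cong isOdd eq)) (codeword-even c-code)) λ ()
  ... | 4 = contradiction (codeword-Σ≡∅ c-code)
              (sidon-⨁-quadruple≢∅ (select L c) (select-⊆ L c) (trans (length-select L c) eq) (select-unique c))
  ... | 5 = contradiction (trans (sym (cong isOdd eq)) (codeword-even c-code)) λ ()
  ... | suc (suc (suc (suc (suc (suc _))))) = s≤s (s≤s (s≤s (s≤s (s≤s (s≤s z≤n)))))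

  codeword-weight : ∀ {c} → Codeword c → c ≢ ∅ → weight c ≡ 6 ⊎ 8 ≤ weight c
  codeword-weight {c} c-code c≢∅ = even-≥6 (weight c) (minimum-weight c-code c≢∅) (codeword-even c-code)
    where
    even-≥6 : ∀ w → 6 ≤ w → isOdd w ≡ false → w ≡ 6 ⊎ 8 ≤ w
    even-≥6 2 (s≤s (s≤s ())) _
    even-≥6 4 (s≤s (s≤s (s≤s (s≤s ())))) _
    even-≥6 6 _ _ = inj₁ refl
    even-≥6 (suc (suc (suc (suc (suc (suc (suc (suc _)))))))) _ _ = inj₂ (s≤s (s≤s (s≤s (s≤s (s≤s (s≤s (s≤s (s≤s z≤n))))))))

  sameKey-overlap : ∀ {p q} → key p ≡ key q → p ≢ q → 2 * weight (p ∩ q) + 6 ≤ weight p + weight q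
  sameKey-overlap {p} {q} kp≡kq p≢q = begin
    2 * weight (p ∩ q) + 6               ≡⟨ +-comm (2 * weight (p ∩ q)) 6 ⟩
    6 + 2 * weight (p ∩ q)               ≤⟨ +-monoˡ-≤ _ (minimum-weight (sameKey⇒codeword kp≡kq) (p≢q ∘ p⊕q≡∅⇒p≡q p q)) ⟩
    weight (p ⊕ q) + 2 * weight (p ∩ q)  ≡⟨ weight-⊕ p q ⟩
    weight p + weight q                  ∎
    where open ≤-Reasoning

  weight-6-overlap : ∀ {d X} → Codeword d → Codeword X → weight X ≡ 6 → d ≢ X → 2 * weight (d ∩ X) ≤ weight d
  weight-6-overlap {d} {X} d-code X-code ∣X∣≡6 d≢X = +-cancelʳ-≤ 6 (2 * weight (d ∩ X)) (weight d)
    (subst (λ k → 2 * weight (d ∩ X) + 6 ≤ weight d + k) ∣X∣≡6 (sameKey-overlap (trans d-code (sym X-code)) d≢X))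

  inside-weight-12⇒weight≡6 : ∀ {d X} → Codeword d → Codeword X → weight X ≡ 12 → d ⊑ X → d ≢ ∅ → d ≢ X → weight d ≡ 6
  inside-weight-12⇒weight≡6 {d} {X} d-code X-code ∣X∣≡12 d⊑X d≢∅ d≢X =
    ≤-antisym (+-cancelʳ-≤ 6 (weight d) 6 (+-cancelˡ-≤ (weight d) _ _ (begin
      weight d + (weight d + 6)    ≡⟨ shift (weight d) ⟨
      2 * weight d + 6             ≡⟨ cong (λ p → 2 * weight p + 6) d⊑X ⟨
      2 * weight (d ∩ X) + 6       ≤⟨ sameKey-overlap (trans d-code (sym X-code)) d≢X ⟩
      weight d + weight X          ≡⟨ cong (weight d +_) ∣X∣≡12 ⟩
      weight d + 12                ∎)))
      (minimum-weight d-code d≢∅)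
    where
    open ≤-Reasoning
    shift : ∀ k → 2 * k + 6 ≡ k + (k + 6)
    shift = solve-∀

  -- The differences p ⊕ q with q in a fibre of key of size > ∣F∣ + 1 are distinct nonzero codewords.
  codeword-avoiding : ∀ z (F : List (Subset s)) → suc (length F) * 2 ^ suc n < 2 ^ weight z →
                      ∃[ d ] d ⊑ z × Codeword d × d ≢ ∅ × d ∉ F
  codeword-avoiding z F bound =
    let (_ , ps , ps⊆ , keys , F<ps) = pigeonhole (suc n) (suc (length F)) key (subsetsOf z)
                                         (subst (_ <_) (sym (length-subsetsOf z)) bound)
    in from-coset ps (AllPairs-resp-⊆ ps⊆ (subsetsOf-unique z)) (All-resp-⊆ ps⊆ (subsetsOf-⊑ z)) keys F<ps
    where
    from-coset : ∀ {κ} ps → Unique ps → All (_⊑ z) ps → All (λ p → key p ≡ κ) ps → suc (length F) < length ps →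
                 ∃[ d ] d ⊑ z × Codeword d × d ≢ ∅ × d ∉ F
    from-coset (p ∷ rest) (p∉rest ∷ rest!) (p⊑z ∷ rest⊑z) (kp ∷ krest) (s≤s F<rest) =
      let (d , d∈ , d∉F)           = longer⇒∃∉ (≡-dec _≟ᵇ_) F (Unique.map⁺ (⊕-cancelˡ p _ _) rest!)
                                       (subst (length F <_) (sym (length-map (p ⊕_) rest)) F<rest)
          (q , q∈rest , d≡p⊕q)     = ∈-map⁻ (p ⊕_) d∈
      in p ⊕ q , ⊑-⊕ p⊑z (All.lookup rest⊑z q∈rest) , sameKey⇒codeword (trans kp (sym (All.lookup krest q∈rest))) ,
         p≢q⇒p⊕q≢∅ (All.lookup p∉rest q∈rest) , subst (_∉ F) d≡p⊕q d∉F

  clique-or-spread : ∀ z r a b → ramseyBound a b ≤ suc r → r * 2 ^ suc n < 2 ^ weight z →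
    (∃[ qs ] All (_⊑ z) qs × AllPairs (λ p q → Codeword (p ⊕ q) × distance p q ≡ 6) qs × length qs ≡ suc a)
    ⊎ (∃[ qs ] All (_⊑ z) qs × AllPairs (λ p q → 8 ≤ distance p q) qs × length qs ≡ suc b)
  clique-or-spread z r a b enough bound =
    let (_ , ps , ps⊆ , keys , r<ps) = pigeonhole (suc n) r key (subsetsOf z) (subst (_ <_) (sym (length-subsetsOf z)) bound)
        ps⊑z   = All-resp-⊆ ps⊆ (subsetsOf-⊑ z)
        coset  = AllPairs.zip (AllPairs-resp-⊆ ps⊆ (subsetsOf-unique z) , sameKeys keys)
    in Sum.map (λ (qs , qs⊆ps , six , l) →
                  qs , All-resp-⊆ qs⊆ps ps⊑z , AllPairs.zipWith codeword-six (AllPairs-resp-⊆ qs⊆ps coset , six) , l)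
               (λ (qs , qs⊆ps , ¬six , l) →
                  qs , All-resp-⊆ qs⊆ps ps⊑z , AllPairs.zipWith eight (AllPairs-resp-⊆ qs⊆ps coset , ¬six) , l)
               (ramsey (λ p q → distance p q ≟ⁿ 6) a b ps (≤-trans enough r<ps))
    where
    sameKeys : ∀ {κ ps} → All (λ p → key p ≡ κ) ps → AllPairs (λ p q → key p ≡ key q) ps
    sameKeys []           = []
    sameKeys (kp ∷ krest) = All.map (λ kq → trans kp (sym kq)) krest ∷ sameKeys krest
    codeword-six : ∀ {p q} → (p ≢ q × key p ≡ key q) × distance p q ≡ 6 → Codeword (p ⊕ q) × distance p q ≡ 6
    codeword-six ((_ , kp≡kq) , d≡6) = sameKey⇒codeword kp≡kq , d≡6
    eight : ∀ {p q} → (p ≢ q × key p ≡ key q) × distance p q ≢ 6 → 8 ≤ distance p q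
    eight ((p≢q , kp≡kq) , d≢6) =
      [ (λ d≡6 → contradiction d≡6 d≢6) , (λ 8≤d → 8≤d) ]′ (codeword-weight (sameKey⇒codeword kp≡kq) (p≢q⇒p⊕q≢∅ p≢q))

  weight-6-codeword-inside : ∀ z → weight z ≡ 11 → 3 * 2 ^ suc n < 2 ^ 11 → ∃[ c ] c ⊑ z × Codeword c × weight c ≡ 6
  weight-6-codeword-inside z ∣z∣≡11 bound =
    [ from-pair , from-spread ]′ (clique-or-spread z 3 1 3 ≤-refl (subst (λ k → 3 * 2 ^ suc n < 2 ^ k) (sym ∣z∣≡11) bound))
    where
    from-pair : (∃[ qs ] All (_⊑ z) qs × AllPairs (λ p q → Codeword (p ⊕ q) × distance p q ≡ 6) qs × length qs ≡ 2) →
                ∃[ c ] c ⊑ z × Codeword c × weight c ≡ 6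
    from-pair (p ∷ q ∷ [] , p⊑z ∷ q⊑z ∷ [] , ((p⊕q-code , d≡6) ∷ []) ∷ [] ∷ [] , refl) = p ⊕ q , ⊑-⊕ p⊑z q⊑z , p⊕q-code , d≡6
    from-spread : (∃[ qs ] All (_⊑ z) qs × AllPairs (λ p q → 8 ≤ distance p q) qs × length qs ≡ 4) →
                  ∃[ c ] c ⊑ z × Codeword c × weight c ≡ 6
    from-spread (qs@(_ ∷ _ ∷ _ ∷ _ ∷ []) , qs⊑z , spread , refl) =
      contradiction (subst (λ k → 48 ≤ 4 * k) ∣z∣≡11 (plotkin-spread 8 z qs qs⊑z spread)) (from-no (48 ≤? 44))

  Triangle : F₂^ n → Subset s → Set
  Triangle w t = weight t ≡ 3 × Σ t ≡ w

  triangle-key : ∀ {w t} → Triangle w t → key t ≡ true ∷ w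
  triangle-key {w} {t} (∣t∣≡3 , Σt≡w) = trans (key≡ t) (cong₂ (λ k v → isOdd k ∷ v) ∣t∣≡3 Σt≡w)

  triangles-disjoint : ∀ {w t t′} → Triangle w t → Triangle w t′ → t ≢ t′ → Disjoint t t′
  triangles-disjoint {t = t} {t′} t-tri t′-tri t≢t′ = weight≡0⇒≡∅ (t ∩ t′) (no-overlap (weight (t ∩ t′)) bound)
    where
    bound : 2 * weight (t ∩ t′) + 6 ≤ 0 + 6
    bound = subst₂ (λ a b → 2 * weight (t ∩ t′) + 6 ≤ a + b) (proj₁ t-tri) (proj₁ t′-tri)
              (sameKey-overlap (trans (triangle-key t-tri) (sym (triangle-key t′-tri))) t≢t′)
    no-overlap : ∀ k → 2 * k + 6 ≤ 0 + 6 → k ≡ 0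
    no-overlap zero    _ = refl
    no-overlap (suc k) 2k+6≤6 with +-cancelʳ-≤ 6 (2 * suc k) 0 2k+6≤6
    ... | ()

  triangles-share⇒≡ : ∀ {w t t′ y} → Triangle w t → Triangle w t′ → y ∈ select L t → y ∈ select L t′ → t ≡ t′
  triangles-share⇒≡ {t = t} {t′} t-tri t′-tri y∈t y∈t′ with ≡-dec _≟ᵇ_ t t′
  ... | yes t≡t′ = t≡t′
  ... | no  t≢t′ = contradiction y∈t′ (select-disjoint t t′ (unique S) (triangles-disjoint t-tri t′-tri t≢t′) y∈t)

  triangle-pair : ∀ {w t t′} → Triangle w t → Triangle w t′ → t ≢ t′ → Codeword (t ⊕ t′) × weight (t ⊕ t′) ≡ 6
  triangle-pair {t = t} {t′} t-tri t′-tri t≢t′ =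
    sameKey⇒codeword (trans (triangle-key t-tri) (sym (triangle-key t′-tri))) ,
    trans (weight-⊕-disjoint t t′ (triangles-disjoint t-tri t′-tri t≢t′)) (cong₂ _+_ (proj₁ t-tri) (proj₁ t′-tri))

  split-codeword : ∀ {c a} → Codeword c → weight c ≡ 6 → a ⊑ c → weight a ≡ 3 → Triangle (Σ a) (c ⊕ a)
  split-codeword {c} {a} c-code ∣c∣≡6 a⊑c ∣a∣≡3 = +-cancelʳ-≡ 6 (weight (c ⊕ a)) 3 weights , Σc⊕a≡Σa
    where
    ∣c∩a∣≡3 : weight (c ∩ a) ≡ 3
    ∣c∩a∣≡3 = trans (cong weight (trans (∩-comm c a) a⊑c)) ∣a∣≡3
    weights : weight (c ⊕ a) + 6 ≡ 3 + 6
    weights = begin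
      weight (c ⊕ a) + 6                  ≡⟨ cong (λ k → weight (c ⊕ a) + 2 * k) ∣c∩a∣≡3 ⟨
      weight (c ⊕ a) + 2 * weight (c ∩ a) ≡⟨ weight-⊕ c a ⟩
      weight c + weight a                 ≡⟨ cong₂ _+_ ∣c∣≡6 ∣a∣≡3 ⟩
      3 + 6                               ∎
      where open ≡-Reasoning
    Σc⊕a≡Σa : Σ (c ⊕ a) ≡ Σ a
    Σc⊕a≡Σa = trans (Σ-⊕ c a) (trans (cong (_⊕ Σ a) (codeword-Σ≡∅ c-code)) (⊕-identityˡ (Σ a)))

  triangle-points : ∀ {w t} → Triangle w t → ∃[ T ] select L t ≡ points T
  triangle-points {t = t} (∣t∣≡3 , _) =
    let (x , y , z , select≡) = length≡3⇒triple (select L t) (trans (length-select L t) ∣t∣≡3) in (x , y , z) , select≡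

  toGerbera : ∀ {w} ts → All (Triangle w) ts → Unique ts → ContainsGerbera (length ts) S
  toGerbera {w} ts tris ts! = w , T , (shape , distinct) , members
    where
    tri : ∀ i → Triangle w (lookup ts i)
    tri i = All.lookup tris (∈-lookup i)
    T : Fin (length ts) → Triple n
    T i = proj₁ (triangle-points (tri i))
    select≡ : ∀ i → select L (lookup ts i) ≡ points (T i)
    select≡ i = proj₂ (triangle-points (tri i))
    ∈T⇒∈select : ∀ i {v} → v ∈T T i → v ∈ select L (lookup ts i)
    ∈T⇒∈select i v∈T = subst (_ ∈_) (sym (select≡ i)) (∈T⇒∈ v∈T)
    shape : ∀ i → let (x , y , z) = T i in x ≢ y × x ≢ z × y ≢ z × x ⊕ y ⊕ z ≡ w
    shape i with subst Unique (select≡ i) (select-unique (lookup ts i))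
    ... | (x≢y ∷ x≢z ∷ []) ∷ (y≢z ∷ []) ∷ [] ∷ [] =
      x≢y , x≢z , y≢z , trans (sym (⨁-points (T i))) (trans (cong ⨁ (sym (select≡ i))) (proj₂ (tri i)))
    distinct : ∀ i j → SameSet (T i) (T j) → i ≡ j
    distinct i j same = Unique-lookup-injective ts! i j
      (triangles-share⇒≡ (tri i) (tri j) (∈T⇒∈select i (inj₁ refl)) (∈T⇒∈select j (Equivalence.to (same _) (inj₁ refl))))
    members : ∀ i → let (x , y , z) = T i in x ∈S S × y ∈S S × z ∈S S
    members i = ∈S (inj₁ refl) , ∈S (inj₂ (inj₁ refl)) , ∈S (inj₂ (inj₂ refl))
      where
      ∈S : ∀ {v} → v ∈T T i → v ∈S S
      ∈S = Any-resp-⊆ (select-⊆ L (lookup ts i)) ∘ ∈T⇒∈select i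

  fromGerbera : ∀ {k} → ContainsGerbera k S → ∃[ w ] ∃[ ts ] All (Triangle w) ts × Unique ts × length ts ≡ k
  fromGerbera {k} (w , T , (shape , distinct) , members) =
    w , tabulate t , All-tabulate⁺ tri , AllPairs-tabulate⁺ (λ i≢j tᵢ≡tⱼ → i≢j (distinct _ _ (same tᵢ≡tⱼ))) ,
    length-tabulate t
    where
    t : Fin k → Subset s
    t i = indicator (_∈T? T i) L
    ∈L : ∀ i {v} → v ∈T T i → v ∈ L
    ∈L i (inj₁ refl)        = proj₁ (members i)
    ∈L i (inj₂ (inj₁ refl)) = proj₁ (proj₂ (members i))
    ∈L i (inj₂ (inj₂ refl)) = proj₂ (proj₂ (members i))
    ∈T⇒∈select : ∀ i {v} → v ∈T T i → v ∈ select L (t i)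
    ∈T⇒∈select i v∈T = subst (_ ∈_) (sym (select-indicator (_∈T? T i) L)) (∈-filter⁺ (_∈T? T i) (∈L i v∈T) v∈T)
    ∈select⇒∈T : ∀ i {v} → v ∈ select L (t i) → v ∈T T i
    ∈select⇒∈T i v∈t = proj₂ (∈-filter⁻ (_∈T? T i) {xs = L} (subst (_ ∈_) (select-indicator (_∈T? T i) L) v∈t))
    points-unique : ∀ i → Unique (points (T i))
    points-unique i = let (x≢y , x≢z , y≢z , _) = shape i in (x≢y ∷ x≢z ∷ []) ∷ (y≢z ∷ []) ∷ [] ∷ []
    select↭points : ∀ i → select L (t i) ↭ points (T i)
    select↭points i = ∼bag⇒↭ (unique∧set⇒bag (select-unique (t i)) (points-unique i)
                        (mk⇔ (∈T⇒∈ ∘ ∈select⇒∈T i) (∈T⇒∈select i ∘ ∈⇒∈T)))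
    tri : ∀ i → Triangle w (t i)
    tri i = trans (sym (length-select L (t i))) (↭-length (select↭points i)) ,
            trans (⨁-↭ (select↭points i)) (trans (⨁-points (T i)) (proj₂ (proj₂ (proj₂ (shape i)))))
    same : ∀ {i j} → t i ≡ t j → SameSet (T i) (T j)
    same {i} {j} tᵢ≡tⱼ v = mk⇔ (∈select⇒∈T j ∘ subst (λ p → v ∈ select L p) tᵢ≡tⱼ ∘ ∈T⇒∈select i)
                              (∈select⇒∈T i ∘ subst (λ p → v ∈ select L p) (sym tᵢ≡tⱼ) ∘ ∈T⇒∈select j)

  gerbera₃-from-codewords : ∀ {c₁ c₂} → Codeword c₁ → Codeword c₂ →
                            weight c₁ ≡ 6 → weight c₂ ≡ 6 → weight (c₁ ⊕ c₂) ≡ 6 → ContainsGerbera 3 S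
  gerbera₃-from-codewords {c₁} {c₂} c₁-code c₂-code ∣c₁∣≡6 ∣c₂∣≡6 ∣c₁⊕c₂∣≡6 =
    toGerbera (a ∷ c₁ ⊕ a ∷ c₂ ⊕ a ∷ [])
      ( (∣a∣≡3 , refl)
      ∷ split-codeword c₁-code ∣c₁∣≡6 (p∩q⊑p c₁ c₂) ∣a∣≡3
      ∷ split-codeword c₂-code ∣c₂∣≡6 (p∩q⊑q c₁ c₂) ∣a∣≡3
      ∷ [])
      (( ≢-by-⊕ (p⊕[q⊕p]≡q a c₁) (weight≡suc⇒≢∅ ∣c₁∣≡6)
       ∷ ≢-by-⊕ (p⊕[q⊕p]≡q a c₂) (weight≡suc⇒≢∅ ∣c₂∣≡6) ∷ [])
       ∷ (≢-by-⊕ ([p⊕r]⊕[q⊕r]≡p⊕q c₁ c₂ a) (weight≡suc⇒≢∅ ∣c₁⊕c₂∣≡6) ∷ []) ∷ [] ∷ [])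
    where
    a = c₁ ∩ c₂
    ∣a∣≡3 : weight a ≡ 3
    ∣a∣≡3 = *-cancelˡ-≡ (weight a) 3 2 (+-cancelˡ-≡ 6 (2 * weight a) 6 (begin
      6 + 2 * weight a                  ≡⟨ cong (_+ 2 * weight a) ∣c₁⊕c₂∣≡6 ⟨
      weight (c₁ ⊕ c₂) + 2 * weight a   ≡⟨ weight-⊕ c₁ c₂ ⟩
      weight c₁ + weight c₂             ≡⟨ cong₂ _+_ ∣c₁∣≡6 ∣c₂∣≡6 ⟩
      12                                ∎))
      where open ≡-Reasoning

  gerbera₃-from-equidistant : ∀ {p₀ p₁ p₂} → Codeword (p₀ ⊕ p₁) → Codeword (p₀ ⊕ p₂) →
                              distance p₀ p₁ ≡ 6 → distance p₀ p₂ ≡ 6 → distance p₁ p₂ ≡ 6 → ContainsGerbera 3 S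
  gerbera₃-from-equidistant {p₀} {p₁} {p₂} c₀₁ c₀₂ d₀₁≡6 d₀₂≡6 d₁₂≡6 =
    gerbera₃-from-codewords c₀₁ c₀₂ d₀₁≡6 d₀₂≡6 (trans (cong weight ([r⊕p]⊕[r⊕q]≡p⊕q p₁ p₂ p₀)) d₁₂≡6)

  halves-of-codeword : ∀ {c c′ d} → Codeword c → Codeword c′ → Codeword d → weight c ≡ 6 → weight c′ ≡ 6 →
                       Disjoint c c′ → d ⊑ (c ⊕ c′) → d ≢ ∅ → d ∉ c ∷ c′ ∷ c ⊕ c′ ∷ [] →
                       weight (d ∩ c) ≡ 3 × weight (d ∩ c′) ≡ 3
  halves-of-codeword {c} {c′} {d} c-code c′-code d-code ∣c∣≡6 ∣c′∣≡6 c∩c′≡∅ d⊑c⊕c′ d≢∅ d∉ =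
    sum≡6⇒≡3 ∣d∩c∣+∣d∩c′∣≡6 (≤3 c-code ∣c∣≡6 (d∉ ∘ here)) (≤3 c′-code ∣c′∣≡6 (d∉ ∘ there ∘ here)) ,
    sum≡6⇒≡3 (trans (+-comm (weight (d ∩ c′)) (weight (d ∩ c))) ∣d∩c∣+∣d∩c′∣≡6)
             (≤3 c′-code ∣c′∣≡6 (d∉ ∘ there ∘ here)) (≤3 c-code ∣c∣≡6 (d∉ ∘ here))
    where
    ∣d∣≡6 : weight d ≡ 6
    ∣d∣≡6 = inside-weight-12⇒weight≡6 d-code (codeword-⊕ c-code c′-code)
              (trans (weight-⊕-disjoint c c′ c∩c′≡∅) (cong₂ _+_ ∣c∣≡6 ∣c′∣≡6)) d⊑c⊕c′ d≢∅ (d∉ ∘ there ∘ there ∘ here)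
    ∣d∩c∣+∣d∩c′∣≡6 : weight (d ∩ c) + weight (d ∩ c′) ≡ 6
    ∣d∩c∣+∣d∩c′∣≡6 = trans (sym (weight-∩-⊕ d c c′ c∩c′≡∅)) (trans (cong weight d⊑c⊕c′) ∣d∣≡6)
    ≤3 : ∀ {x} → Codeword x → weight x ≡ 6 → d ≢ x → weight (d ∩ x) ≤ 3
    ≤3 {x} x-code ∣x∣≡6 d≢x = *-cancelˡ-≤ 2 (subst (2 * weight (d ∩ x) ≤_) ∣d∣≡6 (weight-6-overlap d-code x-code ∣x∣≡6 d≢x))

  gerbera₄-from-codewords : ∀ {c c′ d} → Codeword c → Codeword c′ → Codeword d → weight c ≡ 6 → weight c′ ≡ 6 →
                            Disjoint c c′ → d ⊑ (c ⊕ c′) → d ≢ ∅ → d ∉ c ∷ c′ ∷ c ⊕ c′ ∷ [] → ContainsGerbera 4 S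
  gerbera₄-from-codewords {c} {c′} {d} c-code c′-code d-code ∣c∣≡6 ∣c′∣≡6 c∩c′≡∅ d⊑c⊕c′ d≢∅ d∉ =
    toGerbera (a ∷ c ⊕ a ∷ a′ ∷ c′ ⊕ a′ ∷ [])
      ( (∣a∣≡3 , refl)
      ∷ split-codeword c-code ∣c∣≡6 (p∩q⊑q d c) ∣a∣≡3
      ∷ (∣a′∣≡3 , sym Σa≡Σa′)
      ∷ subst (λ v → Triangle v (c′ ⊕ a′)) (sym Σa≡Σa′) (split-codeword c′-code ∣c′∣≡6 (p∩q⊑q d c′) ∣a′∣≡3)
      ∷ [])
      ( ( ≢-by-⊕ (p⊕[q⊕p]≡q a c) (weight≡suc⇒≢∅ ∣c∣≡6)
        ∷ ≢-by-⊕ (sym d≡a⊕a′) d≢∅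
        ∷ ≢-by-⊕ (trans (⊕-exchangeˡ a c′ a′) (cong (c′ ⊕_) (sym d≡a⊕a′))) (p≢q⇒p⊕q≢∅ (d∉ ∘ there ∘ here ∘ sym))
        ∷ [])
      ∷ ( ≢-by-⊕ (trans (⊕-assoc c a a′) (cong (c ⊕_) (sym d≡a⊕a′))) (p≢q⇒p⊕q≢∅ (d∉ ∘ here ∘ sym))
        ∷ ≢-by-⊕ (trans (⊕-interchange c a c′ a′) (cong ((c ⊕ c′) ⊕_) (sym d≡a⊕a′)))
                 (p≢q⇒p⊕q≢∅ (d∉ ∘ there ∘ there ∘ here ∘ sym))
        ∷ [])
      ∷ (≢-by-⊕ (p⊕[q⊕p]≡q a′ c′) (weight≡suc⇒≢∅ ∣c′∣≡6) ∷ [])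
      ∷ [] ∷ [])
    where
    a  = d ∩ c
    a′ = d ∩ c′
    ∣a∣≡3×∣a′∣≡3 = halves-of-codeword c-code c′-code d-code ∣c∣≡6 ∣c′∣≡6 c∩c′≡∅ d⊑c⊕c′ d≢∅ d∉
    ∣a∣≡3 : weight a ≡ 3
    ∣a∣≡3 = proj₁ ∣a∣≡3×∣a′∣≡3
    ∣a′∣≡3 : weight a′ ≡ 3
    ∣a′∣≡3 = proj₂ ∣a∣≡3×∣a′∣≡3
    d≡a⊕a′ : d ≡ a ⊕ a′
    d≡a⊕a′ = trans (sym d⊑c⊕c′) (∩-distribˡ-⊕ d c c′)
    Σa≡Σa′ : Σ a ≡ Σ a′
    Σa≡Σa′ = p⊕q≡∅⇒p≡q (Σ a) (Σ a′) (trans (sym (Σ-⊕ a a′)) (trans (cong Σ (sym d≡a⊕a′)) (codeword-Σ≡∅ d-code)))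

  pair-overlap : ∀ {w t t′ d} → Triangle w t → Triangle w t′ → t ≢ t′ → Codeword d → weight d ≡ 6 → d ≢ t ⊕ t′ →
                 weight (d ∩ t) + weight (d ∩ t′) ≤ 3
  pair-overlap {t = t} {t′} {d} t-tri t′-tri t≢t′ d-code ∣d∣≡6 d≢t⊕t′ =
    let (t⊕t′-code , ∣t⊕t′∣≡6) = triangle-pair t-tri t′-tri t≢t′ in
    *-cancelˡ-≤ 2 (subst₂ (λ a b → 2 * a ≤ b) (weight-∩-⊕ d t t′ (triangles-disjoint t-tri t′-tri t≢t′)) ∣d∣≡6
                    (weight-6-overlap d-code t⊕t′-code ∣t⊕t′∣≡6 d≢t⊕t′))

  four-triangles : ∀ {w t₀ t₁ t₂ t₃} → All (Triangle w) (t₀ ∷ t₁ ∷ t₂ ∷ t₃ ∷ []) → Unique (t₀ ∷ t₁ ∷ t₂ ∷ t₃ ∷ []) →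
                   Codeword ((t₀ ⊕ t₁) ⊕ (t₂ ⊕ t₃)) × Disjoint (t₀ ⊕ t₁) (t₂ ⊕ t₃) × weight ((t₀ ⊕ t₁) ⊕ (t₂ ⊕ t₃)) ≡ 12
  four-triangles {t₀ = t₀} {t₁} {t₂} {t₃} (tri₀ ∷ tri₁ ∷ tri₂ ∷ tri₃ ∷ [])
    ((t₀≢t₁ ∷ t₀≢t₂ ∷ t₀≢t₃ ∷ []) ∷ (t₁≢t₂ ∷ t₁≢t₃ ∷ []) ∷ (t₂≢t₃ ∷ []) ∷ [] ∷ []) =
    codeword-⊕ (proj₁ pair₀₁) (proj₁ pair₂₃) ,
    halves-disjoint ,
    trans (weight-⊕-disjoint (t₀ ⊕ t₁) (t₂ ⊕ t₃) halves-disjoint) (cong₂ _+_ (proj₂ pair₀₁) (proj₂ pair₂₃))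
    where
    pair₀₁ = triangle-pair tri₀ tri₁ t₀≢t₁
    pair₂₃ = triangle-pair tri₂ tri₃ t₂≢t₃
    halves-disjoint : Disjoint (t₀ ⊕ t₁) (t₂ ⊕ t₃)
    halves-disjoint = disjoint-⊕ˡ (disjoint-⊕ʳ (triangles-disjoint tri₀ tri₂ t₀≢t₂) (triangles-disjoint tri₀ tri₃ t₀≢t₃))
                                  (disjoint-⊕ʳ (triangles-disjoint tri₁ tri₂ t₁≢t₂) (triangles-disjoint tri₁ tri₃ t₁≢t₃))

  no-further-codeword : ∀ {w t₀ t₁ t₂ t₃ d} → All (Triangle w) (t₀ ∷ t₁ ∷ t₂ ∷ t₃ ∷ []) → Unique (t₀ ∷ t₁ ∷ t₂ ∷ t₃ ∷ []) →
    Codeword d → d ⊑ ((t₀ ⊕ t₁) ⊕ (t₂ ⊕ t₃)) → d ≢ ∅ →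
    d ∉ t₀ ⊕ t₁ ∷ t₀ ⊕ t₂ ∷ t₀ ⊕ t₃ ∷ t₁ ⊕ t₂ ∷ t₁ ⊕ t₃ ∷ t₂ ⊕ t₃ ∷ (t₀ ⊕ t₁) ⊕ (t₂ ⊕ t₃) ∷ [] → ⊥
  no-further-codeword {w} {t₀} {t₁} {t₂} {t₃} {d} tris@(tri₀ ∷ tri₁ ∷ tri₂ ∷ tri₃ ∷ [])
    distinct@((t₀≢t₁ ∷ t₀≢t₂ ∷ t₀≢t₃ ∷ []) ∷ (t₁≢t₂ ∷ t₁≢t₃ ∷ []) ∷ (t₂≢t₃ ∷ []) ∷ [] ∷ []) d-code d⊑z d≢∅ d∉ =
    pair-sums≤3⇒total≢6 a₀ a₁ a₂ a₃ total
      (shared tri₀ tri₁ t₀≢t₁ (d∉ ∘ here))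
      (shared tri₀ tri₂ t₀≢t₂ (d∉ ∘ there ∘ here))
      (shared tri₀ tri₃ t₀≢t₃ (d∉ ∘ there ∘ there ∘ here))
      (shared tri₁ tri₂ t₁≢t₂ (d∉ ∘ there ∘ there ∘ there ∘ here))
      (shared tri₁ tri₃ t₁≢t₃ (d∉ ∘ there ∘ there ∘ there ∘ there ∘ here))
      (shared tri₂ tri₃ t₂≢t₃ (d∉ ∘ there ∘ there ∘ there ∘ there ∘ there ∘ here))
    where
    z = (t₀ ⊕ t₁) ⊕ (t₂ ⊕ t₃)
    cover = four-triangles tris distinct
    ∣d∣≡6 : weight d ≡ 6
    ∣d∣≡6 = inside-weight-12⇒weight≡6 d-code (proj₁ cover) (proj₂ (proj₂ cover)) d⊑z d≢∅
              (d∉ ∘ there ∘ there ∘ there ∘ there ∘ there ∘ there ∘ here)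
    a₀ = weight (d ∩ t₀)
    a₁ = weight (d ∩ t₁)
    a₂ = weight (d ∩ t₂)
    a₃ = weight (d ∩ t₃)
    shared : ∀ {t t′} → Triangle w t → Triangle w t′ → t ≢ t′ → d ≢ t ⊕ t′ → weight (d ∩ t) + weight (d ∩ t′) ≤ 3
    shared t-tri t′-tri t≢t′ = pair-overlap t-tri t′-tri t≢t′ d-code ∣d∣≡6
    total : (a₀ + a₁) + (a₂ + a₃) ≡ 6
    total = begin
      (a₀ + a₁) + (a₂ + a₃)                           ≡⟨ cong₂ _+_ (weight-∩-⊕ d t₀ t₁ (triangles-disjoint tri₀ tri₁ t₀≢t₁))
                                                                    (weight-∩-⊕ d t₂ t₃ (triangles-disjoint tri₂ tri₃ t₂≢t₃)) ⟨
      weight (d ∩ (t₀ ⊕ t₁)) + weight (d ∩ (t₂ ⊕ t₃))  ≡⟨ weight-∩-⊕ d (t₀ ⊕ t₁) (t₂ ⊕ t₃) (proj₁ (proj₂ cover)) ⟨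
      weight (d ∩ z)                                  ≡⟨ cong weight d⊑z ⟩
      weight d                                        ≡⟨ ∣d∣≡6 ⟩
      6                                               ∎
      where open ≡-Reasoning

  weight-⊤ : ∀ {m} → ∣ S ∣ ≡ m → weight (⊤ {s}) ≡ m
  weight-⊤ = trans (∣⊤∣≡n s)

  ∣S∣≡9⇒gerbera₃ : ∣ S ∣ ≡ 9 → 2 * 2 ^ suc n < 2 ^ 9 → ContainsGerbera 3 S
  ∣S∣≡9⇒gerbera₃ ∣S∣≡9 bound =
    let (_ , ps , ps⊆ , keys , 2<ps) =
          pigeonhole (suc n) 2 key (subsetsOf (⊤ {s}))
            (subst (2 * 2 ^ suc n <_) (sym (trans (length-subsetsOf (⊤ {s})) (cong (2 ^_) (weight-⊤ ∣S∣≡9)))) bound)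
    in from-coset ps (AllPairs-resp-⊆ ps⊆ (subsetsOf-unique (⊤ {s}))) keys 2<ps
    where
    separated : ∀ {κ p q} → key p ≡ κ → key q ≡ κ → p ≢ q → 6 ≤ distance p q
    separated kp kq p≢q = minimum-weight (sameKey⇒codeword (trans kp (sym kq))) (p≢q⇒p⊕q≢∅ p≢q)
    pairSum-three : ∀ a b c → a + (b + 0) + (c + 0 + 0) ≡ a + b + c
    pairSum-three = solve-∀
    from-coset : ∀ {κ} ps → Unique ps → All (λ p → key p ≡ κ) ps → 2 < length ps → ContainsGerbera 3 S
    from-coset (_ ∷ [])     _ _ (s≤s ())
    from-coset (_ ∷ _ ∷ []) _ _ (s≤s (s≤s ()))
    from-coset (p₀ ∷ p₁ ∷ p₂ ∷ _) ((p₀≢p₁ ∷ p₀≢p₂ ∷ _) ∷ (p₁≢p₂ ∷ _) ∷ _) (k₀ ∷ k₁ ∷ k₂ ∷ _) _ =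
      let spread = subst₂ _≤_ (pairSum-three (distance p₀ p₁) (distance p₀ p₂) (distance p₁ p₂)) (cong (2 *_) (weight-⊤ ∣S∣≡9))
                     (plotkin ⊤ (p₀ ∷ p₁ ∷ p₂ ∷ []) (all⊑⊤ _))
          (d₀₁≡6 , d₀₂≡6 , d₁₂≡6) = sum≤18⇒all≡6 (separated k₀ k₁ p₀≢p₁) (separated k₀ k₂ p₀≢p₂) (separated k₁ k₂ p₁≢p₂) spread
      in gerbera₃-from-equidistant (sameKey⇒codeword (trans k₀ (sym k₁))) (sameKey⇒codeword (trans k₀ (sym k₂)))
           d₀₁≡6 d₀₂≡6 d₁₂≡6

  ∣S∣≡12⇒gerbera₃ : ∣ S ∣ ≡ 12 → 15 * 2 ^ suc n < 2 ^ 12 → ContainsGerbera 3 S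
  ∣S∣≡12⇒gerbera₃ ∣S∣≡12 bound =
    [ from-equidistant , from-spread ]′
      (clique-or-spread ⊤ 15 2 4 (n≤1+n 15) (subst (λ k → 15 * 2 ^ suc n < 2 ^ k) (sym (weight-⊤ ∣S∣≡12)) bound))
    where
    from-equidistant : (∃[ qs ] All (_⊑ ⊤) qs × AllPairs (λ p q → Codeword (p ⊕ q) × distance p q ≡ 6) qs × length qs ≡ 3) →
                       ContainsGerbera 3 S
    from-equidistant (_ ∷ _ ∷ _ ∷ [] , _ , ((c₀₁ , d₀₁≡6) ∷ (c₀₂ , d₀₂≡6) ∷ []) ∷ ((_ , d₁₂≡6) ∷ []) ∷ [] ∷ [] , refl) =
      gerbera₃-from-equidistant c₀₁ c₀₂ d₀₁≡6 d₀₂≡6 d₁₂≡6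
    from-spread : (∃[ qs ] All (_⊑ ⊤) qs × AllPairs (λ p q → 8 ≤ distance p q) qs × length qs ≡ 5) → ContainsGerbera 3 S
    from-spread (qs@(_ ∷ _ ∷ _ ∷ _ ∷ _ ∷ []) , qs⊑⊤ , spread , refl) =
      contradiction (subst (λ k → 80 ≤ 6 * k) (weight-⊤ ∣S∣≡12) (plotkin-spread 8 ⊤ qs qs⊑⊤ spread)) (from-no (80 ≤? 72))

  ∣S∣≡9⇒¬gerbera₄ : ∣ S ∣ ≡ 9 → ¬ ContainsGerbera 4 S
  ∣S∣≡9⇒¬gerbera₄ ∣S∣≡9 gerbera =
    let (_ , ts , tris , distinct , ∣ts∣≡4) = fromGerbera gerbera in too-large ts tris distinct ∣ts∣≡4
    where
    too-large : ∀ {w} ts → All (Triangle w) ts → Unique ts → length ts ≡ 4 → ⊥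
    too-large (t₀ ∷ t₁ ∷ t₂ ∷ t₃ ∷ []) tris distinct refl =
      contradiction (subst₂ _≤_ (proj₂ (proj₂ (four-triangles tris distinct))) ∣S∣≡9 (∣p∣≤n ((t₀ ⊕ t₁) ⊕ (t₂ ⊕ t₃))))
                    (from-no (12 ≤? 9))

  no-gerbera₄ : 8 * 2 ^ suc n < 2 ^ 12 → ¬ ContainsGerbera 4 S
  no-gerbera₄ bound gerbera =
    let (_ , ts , tris , distinct , ∣ts∣≡4) = fromGerbera gerbera in impossible ts tris distinct ∣ts∣≡4
    where
    impossible : ∀ {w} ts → All (Triangle w) ts → Unique ts → length ts ≡ 4 → ⊥
    impossible (t₀ ∷ t₁ ∷ t₂ ∷ t₃ ∷ []) tris distinct refl =
      let (_ , d⊑z , d-code , d≢∅ , d∉) =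
            codeword-avoiding ((t₀ ⊕ t₁) ⊕ (t₂ ⊕ t₃))
              (t₀ ⊕ t₁ ∷ t₀ ⊕ t₂ ∷ t₀ ⊕ t₃ ∷ t₁ ⊕ t₂ ∷ t₁ ⊕ t₃ ∷ t₂ ⊕ t₃ ∷ (t₀ ⊕ t₁) ⊕ (t₂ ⊕ t₃) ∷ [])
              (subst (λ k → 8 * 2 ^ suc n < 2 ^ k) (sym (proj₂ (proj₂ (four-triangles tris distinct)))) bound)
      in no-further-codeword tris distinct d-code d⊑z d≢∅ d∉

  ∣S∣≡17⇒gerbera₄ : ∣ S ∣ ≡ 17 → 3 * 2 ^ suc n < 2 ^ 11 → 4 * 2 ^ suc n < 2 ^ 12 → ContainsGerbera 4 S
  ∣S∣≡17⇒gerbera₄ ∣S∣≡17 bound₁₁ bound₁₂ =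
    first-codeword (subset-of-weight (subst (11 ≤_) (sym ∣S∣≡17) (from-yes (11 ≤? 17))))
    where
    avoid-both : ∀ {c c′} → Codeword c → Codeword c′ → weight c ≡ 6 → weight c′ ≡ 6 → Disjoint c c′ → ContainsGerbera 4 S
    avoid-both {c} {c′} c-code c′-code ∣c∣≡6 ∣c′∣≡6 c∩c′≡∅ =
      let ∣c⊕c′∣≡12 = trans (weight-⊕-disjoint c c′ c∩c′≡∅) (cong₂ _+_ ∣c∣≡6 ∣c′∣≡6)
          (d , d⊑c⊕c′ , d-code , d≢∅ , d∉) = codeword-avoiding (c ⊕ c′) (c ∷ c′ ∷ c ⊕ c′ ∷ [])
                                               (subst (λ k → 4 * 2 ^ suc n < 2 ^ k) (sym ∣c⊕c′∣≡12) bound₁₂)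
      in gerbera₄-from-codewords c-code c′-code d-code ∣c∣≡6 ∣c′∣≡6 c∩c′≡∅ d⊑c⊕c′ d≢∅ d∉
    second-codeword : ∀ {c} → Codeword c → weight c ≡ 6 → (∃[ c′ ] c′ ⊑ ∁ c × Codeword c′ × weight c′ ≡ 6) →
                      ContainsGerbera 4 S
    second-codeword {c} c-code ∣c∣≡6 (c′ , c′⊑∁c , c′-code , ∣c′∣≡6) =
      avoid-both c-code c′-code ∣c∣≡6 ∣c′∣≡6 (⊑-disjoint (∩-idem c) c′⊑∁c (∩-inverseʳ c))
    first-codeword : (∃[ z ] weight z ≡ 11) → ContainsGerbera 4 S
    first-codeword (z , ∣z∣≡11) =
      let (c , _ , c-code , ∣c∣≡6) = weight-6-codeword-inside z ∣z∣≡11 bound₁₁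
      in second-codeword c-code ∣c∣≡6 (weight-6-codeword-inside (∁ c) (trans (∣∁p∣≡n∸∣p∣ c) (cong₂ _∸_ ∣S∣≡17 ∣c∣≡6)) bound₁₁)

  gerbera₄-by-pigeonhole : 3 * 2 ^ n < ∣ S ∣ C 3 → ContainsGerbera 4 S
  gerbera₄-by-pigeonhole bound =
    let (_ , ts , ts⊆ , sums , 3<ts) =
          pigeonhole n 3 Σ (subsetsOfSize 3 s) (subst (3 * 2 ^ n <_) (sym (length-subsetsOfSize 3 s)) bound)
    in from-fibre ts (All-resp-⊆ ts⊆ (subsetsOfSize-weight 3 s)) sums (AllPairs-resp-⊆ ts⊆ (subsetsOfSize-unique 3 s)) 3<ts
    where
    from-fibre : ∀ {w} ts → All (λ t → weight t ≡ 3) ts → All (λ t → Σ t ≡ w) ts → Unique ts → 3 < length ts →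
                 ContainsGerbera 4 S
    from-fibre (_ ∷ [])         _ _ _ (s≤s ())
    from-fibre (_ ∷ _ ∷ [])     _ _ _ (s≤s (s≤s ()))
    from-fibre (_ ∷ _ ∷ _ ∷ []) _ _ _ (s≤s (s≤s (s≤s ())))
    from-fibre (t₀ ∷ t₁ ∷ t₂ ∷ t₃ ∷ _) (∣t₀∣ ∷ ∣t₁∣ ∷ ∣t₂∣ ∷ ∣t₃∣ ∷ _) (Σ₀ ∷ Σ₁ ∷ Σ₂ ∷ Σ₃ ∷ _)
      ((t₀≢t₁ ∷ t₀≢t₂ ∷ t₀≢t₃ ∷ _) ∷ (t₁≢t₂ ∷ t₁≢t₃ ∷ _) ∷ (t₂≢t₃ ∷ _) ∷ _) _ =
      toGerbera (t₀ ∷ t₁ ∷ t₂ ∷ t₃ ∷ [])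
        ((∣t₀∣ , Σ₀) ∷ (∣t₁∣ , Σ₁) ∷ (∣t₂∣ , Σ₂) ∷ (∣t₃∣ , Σ₃) ∷ [])
        ((t₀≢t₁ ∷ t₀≢t₂ ∷ t₀≢t₃ ∷ []) ∷ (t₁≢t₂ ∷ t₁≢t₃ ∷ []) ∷ (t₂≢t₃ ∷ []) ∷ [] ∷ [])

lemma7 : (n : ℕ) (S : FinSubset n) → Sidon S →
    (((n ≡ 6 × ∣ S ∣ ≡ 9) ⊎ (n ≡ 7 × ∣ S ∣ ≡ 12)) →
       ContainsGerbera 3 S × ¬ ContainsGerbera 4 S)
    × (((n ≡ 8 × ∣ S ∣ ≡ 17) ⊎ (n ≡ 8 × ∣ S ∣ ≡ 18) ⊎ (n ≡ 9 × ∣ S ∣ ≡ 22)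
         ⊎ (n ≡ 9 × ∣ S ∣ ≡ 23) ⊎ (n ≡ 9 × ∣ S ∣ ≡ 24)) →
       ContainsGerbera 4 S)
lemma7 n S sidon = three-not-four , four
  where
  open SidonCode S sidon
  at : ∀ {k} (P : ℕ → Set) → n ≡ k → P k → P n
  at P n≡k = subst P (sym n≡k)
  by-pigeonhole : ∀ {k m} → n ≡ k → ∣ S ∣ ≡ m → 3 * 2 ^ k < m C 3 → ContainsGerbera 4 S
  by-pigeonhole n≡k ∣S∣≡m = gerbera₄-by-pigeonhole ∘ subst₂ (λ k m → 3 * 2 ^ k < m C 3) (sym n≡k) (sym ∣S∣≡m)
  three-not-four : ((n ≡ 6 × ∣ S ∣ ≡ 9) ⊎ (n ≡ 7 × ∣ S ∣ ≡ 12)) → ContainsGerbera 3 S × ¬ ContainsGerbera 4 S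
  three-not-four (inj₁ (n≡6 , ∣S∣≡9)) =
    ∣S∣≡9⇒gerbera₃ ∣S∣≡9 (at (λ k → 2 * 2 ^ suc k < 2 ^ 9) n≡6 (from-yes (2 * 2 ^ 7 <? 2 ^ 9))) ,
    ∣S∣≡9⇒¬gerbera₄ ∣S∣≡9
  three-not-four (inj₂ (n≡7 , ∣S∣≡12)) =
    ∣S∣≡12⇒gerbera₃ ∣S∣≡12 (at (λ k → 15 * 2 ^ suc k < 2 ^ 12) n≡7 (from-yes (15 * 2 ^ 8 <? 2 ^ 12))) ,
    no-gerbera₄ (at (λ k → 8 * 2 ^ suc k < 2 ^ 12) n≡7 (from-yes (8 * 2 ^ 8 <? 2 ^ 12)))
  four : ((n ≡ 8 × ∣ S ∣ ≡ 17) ⊎ (n ≡ 8 × ∣ S ∣ ≡ 18) ⊎ (n ≡ 9 × ∣ S ∣ ≡ 22)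
           ⊎ (n ≡ 9 × ∣ S ∣ ≡ 23) ⊎ (n ≡ 9 × ∣ S ∣ ≡ 24)) → ContainsGerbera 4 S
  four (inj₁ (n≡8 , ∣S∣≡17)) =
    ∣S∣≡17⇒gerbera₄ ∣S∣≡17 (at (λ k → 3 * 2 ^ suc k < 2 ^ 11) n≡8 (from-yes (3 * 2 ^ 9 <? 2 ^ 11)))
                            (at (λ k → 4 * 2 ^ suc k < 2 ^ 12) n≡8 (from-yes (4 * 2 ^ 9 <? 2 ^ 12)))
  four (inj₂ (inj₁ (n≡8 , ∣S∣≡18)))                = by-pigeonhole n≡8 ∣S∣≡18 (from-yes (3 * 2 ^ 8 <? 18 C 3))
  four (inj₂ (inj₂ (inj₁ (n≡9 , ∣S∣≡22))))         = by-pigeonhole n≡9 ∣S∣≡22 (from-yes (3 * 2 ^ 9 <? 22 C 3))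
  four (inj₂ (inj₂ (inj₂ (inj₁ (n≡9 , ∣S∣≡23))))) = by-pigeonhole n≡9 ∣S∣≡23 (from-yes (3 * 2 ^ 9 <? 23 C 3))
  four (inj₂ (inj₂ (inj₂ (inj₂ (n≡9 , ∣S∣≡24))))) = by-pigeonhole n≡9 ∣S∣≡24 (from-yes (3 * 2 ^ 9 <? 24 C 3))
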